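{- Let $q$ be a power of a prime $p$ and let $f\in\mathbb{F}_q[T][X^p]$ with $\deg_X f\ge1$ be irreducible in $\mathbb{F}_q[T][X]$. Then there exists an irreducible separable $h\in\mathbb{F}_q[T][X]$ (i.e. $h\notin\mathbb{F}_q[T][X^p]$) such that $\rho_f(P)=\rho_h(P)$ for all primes $P\in\mathbb{F}_q[T]$.
   Context: $\rho_g(P)=|\{Q\bmod P: g(Q)\equiv0\pmod P\}|$ for $g\in\mathbb{F}_q[T][X]$. -}

module Defs where

open import Level using (0ℓ)
open import Data.Nat as ℕ using (ℕ; zero; suc; _∸_; _<ᵇ_)
open import Data.Nat.Divisibility using (_∣_)
open import Data.Bool using (Bool; true; false; if_then_else_)
open import Data.List as List using (List; []; _∷_; length; map; filter; concatMap; replicate; _++_)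
open import Data.List.Relation.Unary.All using (All; all?)
open import Data.List.Membership.Propositional using (_∈_)
open import Data.List.Relation.Unary.Unique.Propositional using (Unique)
open import Data.Vec as Vec using (Vec; toList)
open import Data.Product using (Σ; ∃; _×_; _,_)
open import Data.Sum using (_⊎_)
open import Relation.Nullary using (¬_; Dec; yes; no)
open import Relation.Binary.PropositionalEquality using (_≡_; _≢_)
open import Relation.Binary.Definitions using (DecidableEquality)
open import Algebra.Structures using (IsCommutativeRing)

-- A finite field F_q (equality is propositional; x ⁻¹ is a total
-- function whose value at 0 is irrelevant).

record FiniteField : Set₁ where
  field
    A      : Set
    _≟_    : DecidableEquality A
    0# 1#  : A
    _+_ _*_ : A → A → A
    -_     : A → A
    _⁻¹    : A → A
    isCommutativeRing : IsCommutativeRing _≡_ _+_ _*_ -_ 0# 1#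
    0≢1    : 0# ≢ 1#
    inverse : ∀ x → x ≢ 0# → x * (x ⁻¹) ≡ 1#
    elems    : List A
    complete : ∀ x → x ∈ elems
    unique   : Unique elems

  card : ℕ
  card = length elems

-- Raw ring operations with a "is zero" predicate; polynomial rings are
-- built from these (coefficient lists, lowest degree first; trailing
-- zeros allowed, equality is "difference is zero").

record RawR : Set₁ where
  field
    C     : Set
    0# 1# : C
    _+_ _*_ : C → C → C
    -_    : C → C
    IsZ   : C → Set

module RawOps (R : RawR) where
  open RawR R

  _≈_ : C → C → Set
  a ≈ b = IsZ (a + (- b))

  Unit : C → Set
  Unit u = ∃ λ v → (u * v) ≈ 1#

  Irreducible : C → Set
  Irreducible f = (¬ IsZ f) × (¬ Unit f) ×
    (∀ a b → f ≈ (a * b) → Unit a ⊎ Unit b)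

PolyR : RawR → RawR
PolyR R = record
  { C = List C ; 0# = [] ; 1# = 1# ∷ [] ; _+_ = addP ; _*_ = mulP
  ; -_ = map -_ ; IsZ = All IsZ }
  where
  open RawR R
  addP : List C → List C → List C
  addP [] q = q
  addP (a ∷ p) [] = a ∷ p
  addP (a ∷ p) (b ∷ q) = (a + b) ∷ addP p q
  mulP : List C → List C → List C
  mulP [] q = []
  mulP (a ∷ p) q = addP (map (a *_) q) (0# ∷ mulP p q)

coeff : (R : RawR) → List (RawR.C R) → ℕ → RawR.C R
coeff R [] i = RawR.0# R
coeff R (a ∷ p) zero = a
coeff R (a ∷ p) (suc i) = coeff R p i

module OverField (F : FiniteField) where
  open FiniteField F

  Fraw : RawR
  Fraw = record { C = A ; 0# = 0# ; 1# = 1# ; _+_ = _+_ ; _*_ = _*_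
                ; -_ = -_ ; IsZ = λ a → a ≡ 0# }

  FT : RawR
  FT = PolyR Fraw

  FTX : RawR
  FTX = PolyR FT

  PolyT : Set
  PolyT = List A

  PolyTX : Set
  PolyTX = List PolyT

  private
    _+T_ = RawR._+_ FT
    _*T_ = RawR._*_ FT
    -T_  = RawR.-_ FT

  isZero? : (a : A) → Dec (a ≡ 0#)
  isZero? a = a ≟ 0#

  isZeroT? : (p : PolyT) → Dec (All (λ a → a ≡ 0#) p)
  isZeroT? = all? isZero?

  norm : PolyT → PolyT
  norm [] = []
  norm (a ∷ p) with norm p
  ... | [] = if Relation.Nullary.does (isZero? a) then [] else a ∷ []
  ... | b ∷ r = a ∷ b ∷ r

  -- degree in T (deg 0 := 0; irrelevant for the statement, P is a prime)
  degT : PolyT → ℕ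
  degT p = length (norm p) ∸ 1

  lastOr0 : PolyT → A
  lastOr0 [] = 0#
  lastOr0 (a ∷ []) = a
  lastOr0 (a ∷ b ∷ r) = lastOr0 (b ∷ r)

  remFuel : ℕ → PolyT → PolyT → PolyT
  remFuel zero a P = norm a
  remFuel (suc n) a P with norm a | norm P
  ... | a' | [] = a'
  ... | a' | P'@(_ ∷ _) =
    if length a' <ᵇ length P' then a'
    else remFuel n
      (a' +T (-T (replicate (length a' ∸ length P') 0#
                   ++ map ((lastOr0 a' * (lastOr0 P' ⁻¹)) *_) P')))
      P

  _modT_ : PolyT → PolyT → PolyT
  a modT P = remFuel (suc (length a)) a P

  evalX : PolyTX → PolyT → PolyT
  evalX [] Q = []
  evalX (c ∷ g) Q = c +T (Q *T evalX g Q)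

  allVecs : (n : ℕ) → List (Vec A n)
  allVecs zero = Vec.[] ∷ []
  allVecs (suc n) = concatMap (λ a → map (a Vec.∷_) (allVecs n)) elems

  -- ρ_g(P) = #{ Q mod P : g(Q) ≡ 0 mod P }, residues Q mod P being the
  -- polynomials of degree < deg P (coefficient vectors of length deg P)
  ρ : PolyTX → PolyT → ℕ
  ρ g P = length (filter (λ Q → isZeroT? (evalX g (toList Q) modT P))
                         (allVecs (degT P)))

  InXp : ℕ → PolyTX → Set
  InXp p f = ∀ i → ¬ (p ∣ i) → RawR.IsZ FT (coeff FT f i)

  DegX≥1 : PolyTX → Set
  DegX≥1 f = ∃ λ i → (1 ℕ.≤ i) × (¬ RawR.IsZ FT (coeff FT f i))

  IrreducibleT : PolyT → Set
  IrreducibleT = RawOps.Irreducible FT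

  IrreducibleTX : PolyTX → Set
  IrreducibleTX = RawOps.Irreducible FTX

-- Write f = g(X^p) with g = deflate f. Inflation X ↦ X^p is an injective ring map with a
-- left inverse that is linear over it, so it reflects units and g is again irreducible.
-- For an irreducible, hence prime, P ∈ F_q[T] the Frobenius Q ↦ Q^p is injective on the
-- finite ring F_q[T]/P because (Q - R)^p = Q^p - R^p in characteristic p, so it permutes the
-- residues; since f(Q) = g(Q^p) it maps the roots of f mod P onto those of g, and
-- ρ_f(P) = ρ_g(P). Each deflation divides by p the X-degree of some nonzero term of positive
-- degree, so finitely many deflations reach an irreducible h ∉ F_q[T][X^p].

{-# OPTIONS --safe #-}
module Submission where

open import Defs
open import Level using (0ℓ)
open import Function using (_∘_)
open import Function.Definitions using (Injective)
open import Data.Bool using (true; false; T)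
open import Data.Nat as ℕ using (ℕ; zero; suc; _≤_; _<_; _∸_; z≤n; s≤s; _!; nonTrivial⇒n>1)
import Data.Nat.Properties as ℕ
open import Data.Nat.Divisibility as ℕ using (divides; _∣?_)
import Data.Nat.Primality as ℕ
open import Data.Nat.Induction using (<-Rec; <-rec)
open import Data.Nat.Combinatorics using (_C_; nCk≡n!/k![n-k]!; k![n∸k]!∣n!; nCn≡1)
open import Data.Nat.DivMod using (m/n*n≡m)
open import Data.Fin as Fin using (toℕ; fromℕ; inject₁)
open import Data.Fin.Properties using (toℕ-fromℕ; toℕ-inject₁; toℕ<n)
open import Data.List as List
  using (List; []; _∷_; length; _++_; filter; map; replicate; applyUpTo; concatMap; foldr)
import Data.List.Properties as List
open import Data.List.Relation.Unary.All as All using (All; []; _∷_)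
open import Data.List.Relation.Unary.Any as Any using (here; there)
open import Data.List.Relation.Unary.AllPairs using ([]; _∷_)
open import Data.List.Membership.Propositional using (_∈_)
open import Data.List.Membership.Propositional.Properties
  using (∈-∃++; ∈-++⁻; ∈-++⁺ˡ; ∈-++⁺ʳ; ∈-map⁺; ∈-map⁻; ∈-concat⁺′; ∈-concatMap⁻)
open import Data.List.Relation.Binary.Subset.Propositional using (_⊆_)
open import Data.List.Relation.Unary.Unique.Propositional using (Unique)
import Data.List.Relation.Unary.Unique.Propositional.Properties as Unique
open import Data.List.Relation.Binary.Permutation.Propositional
  using (_↭_; ↭-refl; ↭-sym; ↭-trans; prep; ↭⇒↭ₛ)
open import Data.List.Relation.Binary.Permutation.Propositional.Properties
  using (↭-length; filter-↭) renaming (shift to ↭-shift)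
open import Data.Vec as Vec using (Vec; toList)
import Data.Vec.Properties as Vec
open import Data.Product using (∃; _,_)
open import Data.Sum using (_⊎_; inj₁; inj₂)
open import Data.Empty using (⊥-elim)
open import Relation.Nullary using (¬_; Dec; yes; no; ¬?; _→-dec_)
open import Relation.Unary using (Pred; Decidable)
open import Relation.Binary.PropositionalEquality as ≡ using (_≡_; _≢_)
open import Relation.Binary.Bundles using (Setoid)
open import Relation.Binary.Structures using (IsEquivalence)
open import Algebra.Bundles using (CommutativeRing; CommutativeSemiring; Semiring)
open import Algebra.Structures using (IsCommutativeRing)

module _ {A : Set} where

  unique-⊆⇒↭ : {xs ys : List A} → Unique xs → xs ⊆ ys → length ys ≤ length xs → xs ↭ ys
  unique-⊆⇒↭ {[]}     {[]}    _ _ _ = ↭-refl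
  unique-⊆⇒↭ {x ∷ xs} {ys} (x∉xs ∷ uxs) xs⊆ys |ys|≤ with ∈-∃++ (xs⊆ys (here ≡.refl))
  ... | ys₁ , ys₂ , ≡.refl =
    ↭-trans (prep x (unique-⊆⇒↭ uxs xs⊆ys₁ys₂ |ys₁ys₂|≤)) (↭-sym (↭-shift x ys₁ ys₂))
    where
    xs⊆ys₁ys₂ : xs ⊆ ys₁ ++ ys₂
    xs⊆ys₁ys₂ {y} y∈xs with ∈-++⁻ ys₁ (xs⊆ys (there y∈xs))
    ... | inj₁ y∈ys₁         = ∈-++⁺ˡ y∈ys₁
    ... | inj₂ (here y≡x)    = ⊥-elim (All.lookup x∉xs y∈xs (≡.sym y≡x))
    ... | inj₂ (there y∈ys₂) = ∈-++⁺ʳ ys₁ y∈ys₂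
    |ys₁ys₂|≤ : length (ys₁ ++ ys₂) ≤ length xs
    |ys₁ys₂|≤ = ℕ.≤-pred (≡.subst (_≤ suc (length xs)) |ys|≡ |ys|≤)
      where
      |ys|≡ : length (ys₁ ++ x ∷ ys₂) ≡ suc (length (ys₁ ++ ys₂))
      |ys|≡ = ≡.trans (List.length-++ ys₁) (≡.trans (ℕ.+-suc (length ys₁) (length ys₂))
                (≡.cong suc (≡.sym (List.length-++ ys₁))))

  map-injective-↭ : {f : A → A} {xs : List A} → Injective _≡_ _≡_ f →
                    Unique xs → (∀ x → x ∈ xs) → map f xs ↭ xs
  map-injective-↭ {f} {xs} f-inj uxs complete =
    unique-⊆⇒↭ (Unique.map⁺ f-inj uxs) (λ {y} _ → complete y)
      (ℕ.≤-reflexive (≡.sym (List.length-map f xs)))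

filter-map : {A B : Set} {P : Pred B 0ℓ} (P? : Decidable P) (f : A → B) (xs : List A) →
             filter P? (map f xs) ≡ map f (filter (P? ∘ f) xs)
filter-map P? f [] = ≡.refl
filter-map P? f (x ∷ xs) with P? (f x)
... | yes _ = ≡.cong (f x ∷_) (filter-map P? f xs)
... | no  _ = filter-map P? f xs

length-filter-injective : {A : Set} {P Q : Pred A 0ℓ} (P? : Decidable P) (Q? : Decidable Q)
  {f : A → A} {xs : List A} → Injective _≡_ _≡_ f → Unique xs → (∀ x → x ∈ xs) →
  (∀ x → P x → Q (f x)) → (∀ x → Q (f x) → P x) → length (filter P? xs) ≡ length (filter Q? xs)
length-filter-injective P? Q? {f} {xs} f-inj uxs complete P⇒Qf Qf⇒P = begin
  length (filter P? xs)              ≡⟨ ≡.cong length (List.filter-≐ P? (Q? ∘ f) (P⇒Qf _ , Qf⇒P _) xs) ⟩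
  length (filter (Q? ∘ f) xs)        ≡⟨ List.length-map f (filter (Q? ∘ f) xs) ⟨
  length (map f (filter (Q? ∘ f) xs)) ≡⟨ ≡.cong length (filter-map Q? f xs) ⟨
  length (filter Q? (map f xs))      ≡⟨ ↭-length (filter-↭ Q? (map-injective-↭ f-inj uxs complete)) ⟩
  length (filter Q? xs)              ∎
  where open ≡.≡-Reasoning

prime∤! : ∀ {p} → ℕ.Prime p → ∀ m → m < p → p ℕ.∤ m !
prime∤! {p} p-prime zero    m<p p∣1 with ℕ.∣1⇒≡1 p∣1
prime∤! {.1} (ℕ.prime {{()}} _) zero m<p p∣1 | ≡.refl
prime∤! {p} p-prime (suc m) m<p p∣m! with ℕ.euclidsLemma (suc m) (m !) p-prime p∣m!
... | inj₁ p∣1+m = ℕ.<⇒≱ m<p (ℕ.∣⇒≤ p∣1+m)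
... | inj₂ p∣m!  = prime∤! p-prime m (ℕ.<-trans (ℕ.n<1+n m) m<p) p∣m!

prime∣C : ∀ {p k} → ℕ.Prime p → 0 < k → k < p → p ℕ.∣ p C k
prime∣C {zero}          _       _   ()
prime∣C {p@(suc p-1)} {k} p-prime 0<k k<p
  with ℕ.euclidsLemma (p C k) (k ! ℕ.* (p ∸ k) !) p-prime p∣C*k!*[p-k]!
  where
  instance _ = ℕ._!*_!≢0 k (p ∸ k)
  p∣C*k!*[p-k]! : p ℕ.∣ (p C k) ℕ.* (k ! ℕ.* (p ∸ k) !)
  p∣C*k!*[p-k]! = ≡.subst (p ℕ.∣_)
    (≡.sym (≡.trans (≡.cong (ℕ._* (k ! ℕ.* (p ∸ k) !)) (nCk≡n!/k![n-k]! (ℕ.<⇒≤ k<p)))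
                    (m/n*n≡m (k![n∸k]!∣n! (ℕ.<⇒≤ k<p)))))
    (ℕ.m∣m*n (p-1 !))
... | inj₁ p∣C       = p∣C
... | inj₂ p∣k!*[p-k]! with ℕ.euclidsLemma (k !) ((p ∸ k) !) p-prime p∣k!*[p-k]!
...   | inj₁ p∣k!     = ⊥-elim (prime∤! p-prime k k<p p∣k!)
...   | inj₂ p∣[p-k]! = ⊥-elim (prime∤! p-prime (p ∸ k) (ℕ.∸-monoʳ-< 0<k (ℕ.<⇒≤ k<p)) p∣[p-k]!)

module _ (S : CommutativeSemiring 0ℓ 0ℓ) where
  open CommutativeSemiring S
  open import Algebra.Properties.Semiring.Mult semiring using (_×_; ×-congʳ; ×-homo-1; ×-assoc-*; ×1-homo-*)
  open import Algebra.Properties.Semiring.Exp semiring using (_^_)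
  open import Algebra.Properties.CommutativeSemiring.Binomial S using (theorem; binomialTerm)
  open import Algebra.Properties.Monoid.Sum +-monoid
    using (sum; sum-init-last; sum-cong-≋; sum-replicate-zero)
  open import Relation.Binary.Reasoning.Setoid setoid

  char∣⇒×≈0 : ∀ {p n} → p × 1# ≈ 0# → p ℕ.∣ n → ∀ x → n × x ≈ 0#
  char∣⇒×≈0 {p} char (divides q ≡.refl) x = begin
    (q ℕ.* p) × x              ≈⟨ ×-congʳ (q ℕ.* p) (sym (*-identityˡ x)) ⟩
    (q ℕ.* p) × (1# * x)       ≈⟨ sym (×-assoc-* (q ℕ.* p) 1# x) ⟩
    ((q ℕ.* p) × 1#) * x       ≈⟨ *-congʳ (×1-homo-* q p) ⟩
    ((q × 1#) * (p × 1#)) * x  ≈⟨ *-congʳ (trans (*-congˡ char) (zeroʳ _)) ⟩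
    0# * x                     ≈⟨ zeroˡ x ⟩
    0#                         ∎

  freshmans-dream : ∀ {p} → ℕ.Prime p → p × 1# ≈ 0# → ∀ x y → (x + y) ^ p ≈ x ^ p + y ^ p
  freshmans-dream {zero}  (ℕ.prime {{()}} _)
  freshmans-dream {suc n} p-prime char x y = begin
    (x + y) ^ p                                           ≈⟨ theorem p x y ⟩
    t Fin.zero + sum (t ∘ Fin.suc)                        ≈⟨ +-congˡ (sum-init-last (t ∘ Fin.suc)) ⟩
    t Fin.zero + (sum (t ∘ Fin.suc ∘ inject₁) + t (Fin.suc (fromℕ n)))
                                                          ≈⟨ +-cong t₀ (+-cong middle tₚ) ⟩
    y ^ p + (0# + x ^ p)                                  ≈⟨ +-comm _ _ ⟩
    (0# + x ^ p) + y ^ p                                  ≈⟨ +-congʳ (+-identityˡ _) ⟩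
    x ^ p + y ^ p                                         ∎
    where
    p = suc n
    t = binomialTerm x y p
    t₀ : t Fin.zero ≈ y ^ p
    t₀ = trans (×-homo-1 _) (*-identityˡ _)
    tₚ : t (Fin.suc (fromℕ n)) ≈ x ^ p
    tₚ rewrite toℕ-fromℕ n | nCn≡1 p | ℕ.n∸n≡0 n = trans (×-homo-1 _) (*-identityʳ _)
    middle : sum (t ∘ Fin.suc ∘ inject₁) ≈ 0#
    middle = trans (sum-cong-≋ {n} vanishes) (sum-replicate-zero n)
      where
      vanishes : ∀ i → t (Fin.suc (inject₁ i)) ≈ 0#
      vanishes i = char∣⇒×≈0 char (prime∣C p-prime (s≤s z≤n) (s≤s i<n)) _
        where
        i<n : toℕ (inject₁ i) < n
        i<n = ≡.subst (_< n) (≡.sym (toℕ-inject₁ i)) (toℕ<n i)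

module _ (S : Semiring 0ℓ 0ℓ) where
  open Semiring S
  open import Algebra.Properties.Semiring.Divisibility S using (_∣_; _,_)
  open import Algebra.Properties.Semiring.Exp S using (_^_)
  open import Algebra.Definitions.RawSemiring rawSemiring using (Prime; module Prime)

  prime∣^⇒∣ : ∀ {P x} n → Prime P → P ∣ x ^ suc n → P ∣ x
  prime∣^⇒∣ zero    P-prime (q , qP≈x*1) = q , trans qP≈x*1 (*-identityʳ _)
  prime∣^⇒∣ (suc n) P-prime P∣x^n+2 with Prime.split-∣ P-prime P∣x^n+2
  ... | inj₁ P∣x      = P∣x
  ... | inj₂ P∣x^n+1 = prime∣^⇒∣ n P-prime P∣x^n+1

module Congruence (S : CommutativeRing 0ℓ 0ℓ) (P : CommutativeRing.Carrier S) where
  open CommutativeRing S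
  open import Algebra.Properties.Semiring.Divisibility semiring using (_∣_; _,_)
  open import Algebra.Properties.Ring ring using (-‿distribˡ-*)
  open import Algebra.Properties.CommutativeSemigroup +-commutativeSemigroup using (interchange)
  open import Algebra.Properties.CommutativeSemigroup *-commutativeSemigroup using (xy∙z≈xz∙y)
  open import Relation.Binary.Reasoning.Setoid setoid

  infix 4 _≈ₘ_
  -- A record rather than a Σ-type, so that a and b can be inferred from a proof of a ≈ₘ b.
  record _≈ₘ_ (a b : Carrier) : Set where
    constructor _,_
    field
      multiplier : Carrier
      ≈+multiple : a ≈ b + multiplier * P

  ≈⇒≈ₘ : ∀ {a b} → a ≈ b → a ≈ₘ b
  ≈⇒≈ₘ {a} {b} a≈b = 0# , (begin
    a           ≈⟨ a≈b ⟩
    b           ≈⟨ sym (+-identityʳ b) ⟩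
    b + 0#      ≈⟨ +-congˡ (sym (zeroˡ P)) ⟩
    b + 0# * P  ∎)

  ≈ₘ-refl : ∀ {a} → a ≈ₘ a
  ≈ₘ-refl = ≈⇒≈ₘ refl

  ≈ₘ-sym : ∀ {a b} → a ≈ₘ b → b ≈ₘ a
  ≈ₘ-sym {a} {b} (s , a≈b+sP) = - s , (begin
    b                      ≈⟨ sym (+-identityʳ b) ⟩
    b + 0#                 ≈⟨ +-congˡ (sym (-‿inverseʳ (s * P))) ⟩
    b + (s * P + - (s * P)) ≈⟨ sym (+-assoc b _ _) ⟩
    (b + s * P) + - (s * P) ≈⟨ +-cong (sym a≈b+sP) (-‿distribˡ-* s P) ⟩
    a + - s * P            ∎)

  ≈ₘ-trans : ∀ {a b c} → a ≈ₘ b → b ≈ₘ c → a ≈ₘ c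
  ≈ₘ-trans {a} {b} {c} (s , a≈b+sP) (t , b≈c+tP) = t + s , (begin
    a                    ≈⟨ a≈b+sP ⟩
    b + s * P            ≈⟨ +-congʳ b≈c+tP ⟩
    (c + t * P) + s * P  ≈⟨ +-assoc c _ _ ⟩
    c + (t * P + s * P)  ≈⟨ +-congˡ (sym (distribʳ P t s)) ⟩
    c + (t + s) * P      ∎)

  ≈ₘ-setoid : Setoid 0ℓ 0ℓ
  ≈ₘ-setoid = record
    { _≈_ = _≈ₘ_
    ; isEquivalence = record { refl = ≈ₘ-refl ; sym = ≈ₘ-sym ; trans = ≈ₘ-trans }
    }

  x≈ₘx-sP : ∀ x s → x ≈ₘ x + - (s * P)
  x≈ₘx-sP x s = s , (begin
    x                            ≈⟨ sym (+-identityʳ x) ⟩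
    x + 0#                       ≈⟨ +-congˡ (sym (-‿inverseˡ (s * P))) ⟩
    x + (- (s * P) + s * P)      ≈⟨ sym (+-assoc x _ _) ⟩
    (x + - (s * P)) + s * P      ∎)

  +-cong-≈ₘ : ∀ {a b c d} → a ≈ₘ b → c ≈ₘ d → a + c ≈ₘ b + d
  +-cong-≈ₘ {a} {b} {c} {d} (s , a≈b+sP) (t , c≈d+tP) = s + t , (begin
    a + c                        ≈⟨ +-cong a≈b+sP c≈d+tP ⟩
    (b + s * P) + (d + t * P)    ≈⟨ interchange b _ d _ ⟩
    (b + d) + (s * P + t * P)    ≈⟨ +-congˡ (sym (distribʳ P s t)) ⟩
    (b + d) + (s + t) * P        ∎)

  *-congʳ-≈ₘ : ∀ {a b} c → a ≈ₘ b → a * c ≈ₘ b * c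
  *-congʳ-≈ₘ {a} {b} c (s , a≈b+sP) = s * c , (begin
    a * c                ≈⟨ *-congʳ a≈b+sP ⟩
    (b + s * P) * c      ≈⟨ distribʳ c b _ ⟩
    b * c + (s * P) * c  ≈⟨ +-congˡ (xy∙z≈xz∙y s P c) ⟩
    b * c + (s * c) * P  ∎)

  *-cong-≈ₘ : ∀ {a b c d} → a ≈ₘ b → c ≈ₘ d → a * c ≈ₘ b * d
  *-cong-≈ₘ {a} {b} {c} {d} a≈ₘb c≈ₘd = ≈ₘ-trans (*-congʳ-≈ₘ c a≈ₘb)
    (≈ₘ-trans (≈⇒≈ₘ (*-comm b c)) (≈ₘ-trans (*-congʳ-≈ₘ b c≈ₘd) (≈⇒≈ₘ (*-comm d b))))

  +-cancelʳ-≈ₘ : ∀ {a b} c → a + c ≈ₘ b + c → a ≈ₘ b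
  +-cancelʳ-≈ₘ {a} {b} c a+c≈ₘb+c =
    ≈ₘ-trans (≈⇒≈ₘ (sym (cancel a))) (≈ₘ-trans (+-cong-≈ₘ a+c≈ₘb+c (≈ₘ-refl { - c})) (≈⇒≈ₘ (cancel b)))
    where
    cancel : ∀ x → (x + c) + - c ≈ x
    cancel x = trans (+-assoc x c (- c)) (trans (+-congˡ (-‿inverseʳ c)) (+-identityʳ x))

  ∣⇒≈ₘ0 : ∀ {x} → P ∣ x → x ≈ₘ 0#
  ∣⇒≈ₘ0 (q , qP≈x) = q , trans (sym qP≈x) (sym (+-identityˡ _))

  ≈ₘ0⇒∣ : ∀ {x} → x ≈ₘ 0# → P ∣ x
  ≈ₘ0⇒∣ (q , x≈0+qP) = q , sym (trans x≈0+qP (+-identityˡ _))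

-- Built on the raw operations of PolyR, so that the results apply verbatim to the notions of Defs.
module Polynomial
  (R : RawR) {_≈ᴿ_ : RawR.C R → RawR.C R → Set}
  (isCommRing : IsCommutativeRing _≈ᴿ_ (RawR._+_ R) (RawR._*_ R) (RawR.-_ R) (RawR.0# R) (RawR.1# R))
  (IsZ⇒≈0 : ∀ {x} → RawR.IsZ R x → x ≈ᴿ RawR.0# R)
  (≈0⇒IsZ : ∀ {x} → x ≈ᴿ RawR.0# R → RawR.IsZ R x)
  where

  coeffRing : CommutativeRing 0ℓ 0ℓ
  coeffRing = record { isCommutativeRing = isCommRing }

  open CommutativeRing coeffRing
  open import Algebra.Properties.Ring ring using (-0#≈0#)
  open import Algebra.Properties.CommutativeSemigroup +-commutativeSemigroup using (interchange; x∙yz≈y∙xz)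

  Pol : Set
  Pol = List Carrier

  infixl 6 _⊕_
  infixl 7 _⊛_ _·_
  infix  8 ⊝_
  infixl 9 _⟨_⟩

  _⊕_ : Pol → Pol → Pol
  _⊕_ = RawR._+_ (PolyR R)

  _⊛_ : Pol → Pol → Pol
  _⊛_ = RawR._*_ (PolyR R)

  ⊝_ : Pol → Pol
  ⊝_ = RawR.-_ (PolyR R)

  𝟙 : Pol
  𝟙 = 1# ∷ []

  _·_ : Carrier → Pol → Pol
  a · f = map (a *_) f

  _⟨_⟩ : Pol → ℕ → Carrier
  f ⟨ i ⟩ = coeff R f i

  -- Coefficientwise equality: lists that differ by trailing zeros are equal.
  infix 4 _≋_
  record _≋_ (f g : Pol) : Set where
    constructor coeffwise
    field coeff-≈ : ∀ i → f ⟨ i ⟩ ≈ g ⟨ i ⟩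
  open _≋_ public

  ≋-refl : ∀ {f} → f ≋ f
  ≋-refl = coeffwise λ _ → refl

  ≋-sym : ∀ {f g} → f ≋ g → g ≋ f
  ≋-sym f≋g = coeffwise λ i → sym (coeff-≈ f≋g i)

  ≋-trans : ∀ {f g h} → f ≋ g → g ≋ h → f ≋ h
  ≋-trans f≋g g≋h = coeffwise λ i → trans (coeff-≈ f≋g i) (coeff-≈ g≋h i)

  ≋-isEquivalence : IsEquivalence _≋_
  ≋-isEquivalence = record { refl = ≋-refl ; sym = ≋-sym ; trans = ≋-trans }

  ∷-cong : ∀ {a b f g} → a ≈ b → f ≋ g → a ∷ f ≋ b ∷ g
  ∷-cong a≈b f≋g = coeffwise λ { zero → a≈b ; (suc i) → coeff-≈ f≋g i }

  ∷-≋[] : ∀ {a f} → a ≈ 0# → f ≋ [] → a ∷ f ≋ []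
  ∷-≋[] a≈0 f≋[] = coeffwise λ { zero → a≈0 ; (suc i) → coeff-≈ f≋[] i }

  ∷-cancel : ∀ {a b f g} → a ∷ f ≋ b ∷ g → f ≋ g
  ∷-cancel af≋bg = coeffwise λ i → coeff-≈ af≋bg (suc i)

  ∷≋[]-cancel : ∀ {a f} → a ∷ f ≋ [] → f ≋ []
  ∷≋[]-cancel af≋[] = coeffwise λ i → coeff-≈ af≋[] (suc i)

  coeff-≥length : ∀ f {i} → length f ≤ i → f ⟨ i ⟩ ≡ 0#
  coeff-≥length []      _         = ≡.refl
  coeff-≥length (a ∷ f) (s≤s len≤i) = coeff-≥length f len≤i

  coeff-⊕ : ∀ f g i → (f ⊕ g) ⟨ i ⟩ ≈ f ⟨ i ⟩ + g ⟨ i ⟩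
  coeff-⊕ []      g       i       = sym (+-identityˡ _)
  coeff-⊕ (a ∷ f) []      i       = sym (+-identityʳ _)
  coeff-⊕ (a ∷ f) (b ∷ g) zero    = refl
  coeff-⊕ (a ∷ f) (b ∷ g) (suc i) = coeff-⊕ f g i

  coeff-⊝ : ∀ f i → (⊝ f) ⟨ i ⟩ ≈ - f ⟨ i ⟩
  coeff-⊝ []      i       = sym -0#≈0#
  coeff-⊝ (a ∷ f) zero    = refl
  coeff-⊝ (a ∷ f) (suc i) = coeff-⊝ f i

  coeff-· : ∀ a f i → (a · f) ⟨ i ⟩ ≈ a * f ⟨ i ⟩
  coeff-· a []      i       = sym (zeroʳ a)
  coeff-· a (b ∷ f) zero    = refl
  coeff-· a (b ∷ f) (suc i) = coeff-· a f i

  ⊕-cong : ∀ {f f′ g g′} → f ≋ f′ → g ≋ g′ → f ⊕ g ≋ f′ ⊕ g′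
  ⊕-cong {f} {f′} {g} {g′} f≋f′ g≋g′ = coeffwise λ i →
    trans (coeff-⊕ f g i) (trans (+-cong (coeff-≈ f≋f′ i) (coeff-≈ g≋g′ i)) (sym (coeff-⊕ f′ g′ i)))

  ⊕-comm : ∀ f g → f ⊕ g ≋ g ⊕ f
  ⊕-comm f g = coeffwise λ i → trans (coeff-⊕ f g i) (trans (+-comm _ _) (sym (coeff-⊕ g f i)))

  ⊕-assoc : ∀ f g h → (f ⊕ g) ⊕ h ≋ f ⊕ (g ⊕ h)
  ⊕-assoc f g h = coeffwise λ i →
    trans (coeff-⊕ (f ⊕ g) h i) (trans (+-congʳ (coeff-⊕ f g i)) (trans (+-assoc _ _ _)
      (sym (trans (coeff-⊕ f (g ⊕ h) i) (+-congˡ (coeff-⊕ g h i))))))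

  ⊕-identityʳ : ∀ f → f ⊕ [] ≋ f
  ⊕-identityʳ f = coeffwise λ i → trans (coeff-⊕ f [] i) (+-identityʳ _)

  ⊕-inverseˡ : ∀ f → ⊝ f ⊕ f ≋ []
  ⊕-inverseˡ f = coeffwise λ i → trans (coeff-⊕ (⊝ f) f i) (trans (+-congʳ (coeff-⊝ f i)) (-‿inverseˡ _))

  ⊕-inverseʳ : ∀ f → f ⊕ ⊝ f ≋ []
  ⊕-inverseʳ f = ≋-trans (⊕-comm f (⊝ f)) (⊕-inverseˡ f)

  ⊕-interchange : ∀ f g h k → (f ⊕ g) ⊕ (h ⊕ k) ≋ (f ⊕ h) ⊕ (g ⊕ k)
  ⊕-interchange f g h k = coeffwise λ i →
    trans (coeff-⊕ (f ⊕ g) (h ⊕ k) i) (trans (+-cong (coeff-⊕ f g i) (coeff-⊕ h k i))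
      (trans (interchange _ _ _ _)
        (sym (trans (coeff-⊕ (f ⊕ h) (g ⊕ k) i) (+-cong (coeff-⊕ f h i) (coeff-⊕ g k i))))))

  ⊕-left-comm : ∀ f g h → f ⊕ (g ⊕ h) ≋ g ⊕ (f ⊕ h)
  ⊕-left-comm f g h = coeffwise λ i →
    trans (coeff-⊕ f (g ⊕ h) i) (trans (+-congˡ (coeff-⊕ g h i)) (trans (x∙yz≈y∙xz _ _ _)
      (sym (trans (coeff-⊕ g (f ⊕ h) i) (+-congˡ (coeff-⊕ f h i))))))

  ⊝-cong : ∀ {f g} → f ≋ g → ⊝ f ≋ ⊝ g
  ⊝-cong {f} {g} f≋g = coeffwise λ i →
    trans (coeff-⊝ f i) (trans (-‿cong (coeff-≈ f≋g i)) (sym (coeff-⊝ g i)))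

  ·-cong : ∀ {a b f g} → a ≈ b → f ≋ g → a · f ≋ b · g
  ·-cong {a} {b} {f} {g} a≈b f≋g = coeffwise λ i →
    trans (coeff-· a f i) (trans (*-cong a≈b (coeff-≈ f≋g i)) (sym (coeff-· b g i)))

  ·-distribˡ-⊕ : ∀ a f g → a · (f ⊕ g) ≋ a · f ⊕ a · g
  ·-distribˡ-⊕ a f g = coeffwise λ i →
    trans (coeff-· a (f ⊕ g) i) (trans (*-congˡ (coeff-⊕ f g i)) (trans (distribˡ _ _ _)
      (sym (trans (coeff-⊕ (a · f) (a · g) i) (+-cong (coeff-· a f i) (coeff-· a g i))))))

  ·-distribʳ-+ : ∀ a b f → (a + b) · f ≋ a · f ⊕ b · f
  ·-distribʳ-+ a b f = coeffwise λ i →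
    trans (coeff-· (a + b) f i) (trans (distribʳ _ _ _)
      (sym (trans (coeff-⊕ (a · f) (b · f) i) (+-cong (coeff-· a f i) (coeff-· b f i)))))

  ·-assoc : ∀ a b f → a · (b · f) ≋ (a * b) · f
  ·-assoc a b f = coeffwise λ i →
    trans (coeff-· a (b · f) i) (trans (*-congˡ (coeff-· b f i))
      (trans (sym (*-assoc _ _ _)) (sym (coeff-· (a * b) f i))))

  ·-zeroˡ : ∀ f → 0# · f ≋ []
  ·-zeroˡ f = coeffwise λ i → trans (coeff-· 0# f i) (zeroˡ _)

  ·-identityˡ : ∀ f → 1# · f ≋ f
  ·-identityˡ f = coeffwise λ i → trans (coeff-· 1# f i) (*-identityˡ _)

  ⊛-zeroʳ : ∀ f → f ⊛ [] ≋ []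
  ⊛-zeroʳ []      = ≋-refl
  ⊛-zeroʳ (a ∷ f) = ∷-≋[] refl (⊛-zeroʳ f)

  ⊛-congʳ : ∀ f {g g′} → g ≋ g′ → f ⊛ g ≋ f ⊛ g′
  ⊛-congʳ []      g≋g′ = ≋-refl
  ⊛-congʳ (a ∷ f) g≋g′ = ⊕-cong (·-cong refl g≋g′) (∷-cong refl (⊛-congʳ f g≋g′))

  ⊛-∷ʳ : ∀ f a g → f ⊛ (a ∷ g) ≋ a · f ⊕ (0# ∷ f ⊛ g)
  ⊛-∷ʳ []      a g = ≋-sym (∷-≋[] refl ≋-refl)
  ⊛-∷ʳ (b ∷ f) a g = ∷-cong (+-congʳ (*-comm b a))
    (≋-trans (⊕-cong ≋-refl (⊛-∷ʳ f a g)) (⊕-left-comm (b · g) (a · f) (0# ∷ f ⊛ g)))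

  ⊛-comm : ∀ f g → f ⊛ g ≋ g ⊛ f
  ⊛-comm []      g = ≋-sym (⊛-zeroʳ g)
  ⊛-comm (a ∷ f) g = ≋-trans (⊕-cong ≋-refl (∷-cong refl (⊛-comm f g))) (≋-sym (⊛-∷ʳ g a f))

  ⊛-congˡ : ∀ {f f′} g → f ≋ f′ → f ⊛ g ≋ f′ ⊛ g
  ⊛-congˡ {f} {f′} g f≋f′ = ≋-trans (⊛-comm f g) (≋-trans (⊛-congʳ g f≋f′) (⊛-comm g f′))

  ⊛-cong : ∀ {f f′ g g′} → f ≋ f′ → g ≋ g′ → f ⊛ g ≋ f′ ⊛ g′
  ⊛-cong {f′ = f′} {g} f≋f′ g≋g′ = ≋-trans (⊛-congˡ g f≋f′) (⊛-congʳ f′ g≋g′)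

  0∷-⊛ : ∀ f g → (0# ∷ f) ⊛ g ≋ 0# ∷ f ⊛ g
  0∷-⊛ f g = ⊕-cong (·-zeroˡ g) ≋-refl

  ·-⊛ : ∀ a f g → a · f ⊛ g ≋ a · (f ⊛ g)
  ·-⊛ a []      g = ≋-refl
  ·-⊛ a (b ∷ f) g = ≋-trans (⊕-cong (≋-sym (·-assoc a b g)) (∷-cong (sym (zeroʳ a)) (·-⊛ a f g)))
    (≋-sym (·-distribˡ-⊕ a (b · g) (0# ∷ f ⊛ g)))

  ⊛-distribʳ : ∀ f g h → (f ⊕ g) ⊛ h ≋ f ⊛ h ⊕ g ⊛ h
  ⊛-distribʳ []      g       h = ≋-refl
  ⊛-distribʳ (a ∷ f) []      h = ≋-sym (⊕-identityʳ _)
  ⊛-distribʳ (a ∷ f) (b ∷ g) h = ≋-trans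
    (⊕-cong (·-distribʳ-+ a b h) (∷-cong (sym (+-identityʳ 0#)) (⊛-distribʳ f g h)))
    (⊕-interchange (a · h) (b · h) (0# ∷ f ⊛ h) (0# ∷ g ⊛ h))

  ⊛-distribˡ : ∀ f g h → f ⊛ (g ⊕ h) ≋ f ⊛ g ⊕ f ⊛ h
  ⊛-distribˡ f g h = ≋-trans (⊛-comm f (g ⊕ h))
    (≋-trans (⊛-distribʳ g h f) (⊕-cong (⊛-comm g f) (⊛-comm h f)))

  ⊛-assoc : ∀ f g h → (f ⊛ g) ⊛ h ≋ f ⊛ (g ⊛ h)
  ⊛-assoc []      g h = ≋-refl
  ⊛-assoc (a ∷ f) g h = ≋-trans (⊛-distribʳ (a · g) (0# ∷ f ⊛ g) h)
    (⊕-cong (·-⊛ a g h) (≋-trans (0∷-⊛ (f ⊛ g) h) (∷-cong refl (⊛-assoc f g h))))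

  ⊛-identityˡ : ∀ f → 𝟙 ⊛ f ≋ f
  ⊛-identityˡ f = ≋-trans (⊕-cong (·-identityˡ f) (∷-≋[] refl ≋-refl)) (⊕-identityʳ f)

  ⊛-identityʳ : ∀ f → f ⊛ 𝟙 ≋ f
  ⊛-identityʳ f = ≋-trans (⊛-comm f 𝟙) (⊛-identityˡ f)

  ⊕-⊛-isCommutativeRing : IsCommutativeRing _≋_ _⊕_ _⊛_ ⊝_ [] 𝟙
  ⊕-⊛-isCommutativeRing = record
    { isRing = record
      { +-isAbelianGroup = record
        { isGroup = record
          { isMonoid = record
            { isSemigroup = record
              { isMagma = record { isEquivalence = ≋-isEquivalence ; ∙-cong = ⊕-cong }
              ; assoc = ⊕-assoc }
            ; identity = (λ _ → ≋-refl) , ⊕-identityʳ }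
          ; inverse = ⊕-inverseˡ , ⊕-inverseʳ
          ; ⁻¹-cong = ⊝-cong }
        ; comm = ⊕-comm }
      ; *-cong = ⊛-cong
      ; *-assoc = ⊛-assoc
      ; *-identity = ⊛-identityˡ , ⊛-identityʳ
      ; distrib = ⊛-distribˡ , λ f g h → ⊛-distribʳ g h f }
    ; *-comm = ⊛-comm }

  polyRing : CommutativeRing 0ℓ 0ℓ
  polyRing = record { isCommutativeRing = ⊕-⊛-isCommutativeRing }

  private module Raw = RawOps (PolyR R)
  open import Algebra.Properties.Group (CommutativeRing.+-group polyRing) using (x∙y⁻¹≈ε⇒x≈y; x≈y⇒x∙y⁻¹≈ε)

  All-IsZ⇒≋[] : ∀ {f} → All (RawR.IsZ R) f → f ≋ []
  All-IsZ⇒≋[] []       = ≋-refl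
  All-IsZ⇒≋[] (a≈0 ∷ f≈0) = ∷-≋[] (IsZ⇒≈0 a≈0) (All-IsZ⇒≋[] f≈0)

  ≋[]⇒All-IsZ : ∀ {f} → f ≋ [] → All (RawR.IsZ R) f
  ≋[]⇒All-IsZ {[]}    _    = []
  ≋[]⇒All-IsZ {a ∷ f} f≋[] = ≈0⇒IsZ (coeff-≈ f≋[] 0) ∷ ≋[]⇒All-IsZ (∷≋[]-cancel f≋[])

  ≈ᵣ⇒≋ : ∀ {f g} → f Raw.≈ g → f ≋ g
  ≈ᵣ⇒≋ f-g≈0 = x∙y⁻¹≈ε⇒x≈y _ _ (All-IsZ⇒≋[] f-g≈0)

  ≋⇒≈ᵣ : ∀ {f g} → f ≋ g → f Raw.≈ g
  ≋⇒≈ᵣ f≋g = ≋[]⇒All-IsZ (x≈y⇒x∙y⁻¹≈ε f≋g)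

  IsUnit : Pol → Set
  IsUnit u = ∃ λ v → u ⊛ v ≋ 𝟙

  Unitᵣ⇒IsUnit : ∀ {u} → Raw.Unit u → IsUnit u
  Unitᵣ⇒IsUnit (v , uv≈1) = v , ≈ᵣ⇒≋ uv≈1

  IsUnit⇒Unitᵣ : ∀ {u} → IsUnit u → Raw.Unit u
  IsUnit⇒Unitᵣ (v , uv≋1) = v , ≋⇒≈ᵣ uv≋1

  IsUnit-resp-≋ : ∀ {u u′} → u ≋ u′ → IsUnit u → IsUnit u′
  IsUnit-resp-≋ u≋u′ (v , uv≋1) = v , ≋-trans (⊛-congˡ v (≋-sym u≋u′)) uv≋1

  module _ where
    open import Algebra.Definitions.RawSemiring (Semiring.rawSemiring (CommutativeRing.semiring polyRing))
      using (Irreducible; mkIrred)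
    open import Algebra.Properties.Semiring.Divisibility (CommutativeRing.semiring polyRing) using (_∣_; _,_)

    Irreducibleᵣ⇒Irreducible : ∀ {f} → Raw.Irreducible f → Irreducible f
    Irreducibleᵣ⇒Irreducible {f} (_ , f-nonunit , f-split) = mkIrred f∤1 split-∣1
      where
      f∤1 : ¬ f ∣ 𝟙
      f∤1 (q , qf≋1) = f-nonunit (IsUnit⇒Unitᵣ {f} (q , ≋-trans (⊛-comm f q) qf≋1))
      divides-𝟙 : ∀ {u} → Raw.Unit u → u ∣ 𝟙
      divides-𝟙 {u} unit with Unitᵣ⇒IsUnit {u} unit
      ... | v , uv≋1 = v , ≋-trans (⊛-comm v u) uv≋1
      split-∣1 : ∀ {g h} → f ≋ g ⊛ h → g ∣ 𝟙 ⊎ h ∣ 𝟙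
      split-∣1 {g} {h} f≋gh with f-split g h (≋⇒≈ᵣ f≋gh)
      ... | inj₁ g-unit = inj₁ (divides-𝟙 {g} g-unit)
      ... | inj₂ h-unit = inj₂ (divides-𝟙 {h} h-unit)

    Irreducibleᵣ⇒≉[] : ∀ {f} → Raw.Irreducible f → ¬ f ≋ []
    Irreducibleᵣ⇒≉[] (f≉0 , _) f≋[] = f≉0 (≋[]⇒All-IsZ f≋[])

  shift : ℕ → Pol → Pol
  shift n f = replicate n 0# ++ f

  coeff-shift-+ : ∀ n f i → shift n f ⟨ n ℕ.+ i ⟩ ≡ f ⟨ i ⟩
  coeff-shift-+ zero    f i = ≡.refl
  coeff-shift-+ (suc n) f i = coeff-shift-+ n f i

  coeff-shift-< : ∀ n f {i} → i < n → shift n f ⟨ i ⟩ ≡ 0#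
  coeff-shift-< (suc n) f {zero}  _         = ≡.refl
  coeff-shift-< (suc n) f {suc i} (s≤s i<n) = coeff-shift-< n f i<n

  shift-cong : ∀ n {f g} → f ≋ g → shift n f ≋ shift n g
  shift-cong zero    f≋g = f≋g
  shift-cong (suc n) f≋g = ∷-cong refl (shift-cong n f≋g)

  shift-[] : ∀ n → shift n [] ≋ []
  shift-[] zero    = ≋-refl
  shift-[] (suc n) = ∷-≋[] refl (shift-[] n)

  shift-⊛ : ∀ n f g → shift n f ⊛ g ≋ shift n (f ⊛ g)
  shift-⊛ zero    f g = ≋-refl
  shift-⊛ (suc n) f g = ≋-trans (0∷-⊛ (shift n f) g) (∷-cong refl (shift-⊛ n f g))

  coeff-applyUpTo : ∀ (a : ℕ → Carrier) n j → (n ≤ j → a j ≈ 0#) → applyUpTo a n ⟨ j ⟩ ≈ a j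
  coeff-applyUpTo a zero    j       a≈0 = sym (a≈0 z≤n)
  coeff-applyUpTo a (suc n) zero    _   = refl
  coeff-applyUpTo a (suc n) (suc j) a≈0 = coeff-applyUpTo (a ∘ suc) n j (a≈0 ∘ s≤s)

  eval : Pol → Carrier → Carrier
  eval []      x = 0#
  eval (c ∷ g) x = c + x * eval g x

  eval-≋[] : ∀ {g} x → g ≋ [] → eval g x ≈ 0#
  eval-≋[] {[]}    x _     = refl
  eval-≋[] {c ∷ g} x cg≋[] =
    trans (+-cong (coeff-≈ cg≋[] 0) (trans (*-congˡ (eval-≋[] x (∷≋[]-cancel cg≋[]))) (zeroʳ x)))
          (+-identityʳ 0#)

  eval-cong : ∀ {g h} x → g ≋ h → eval g x ≈ eval h x
  eval-cong {[]}    {h}     x []≋h = sym (eval-≋[] x (≋-sym []≋h))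
  eval-cong {c ∷ g} {[]}    x cg≋[] = eval-≋[] x cg≋[]
  eval-cong {c ∷ g} {d ∷ h} x cg≋dh = +-cong (coeff-≈ cg≋dh 0) (*-congˡ (eval-cong x (∷-cancel cg≋dh)))

  open import Algebra.Properties.Semiring.Exp semiring using (_^_)

  eval-shift : ∀ n g x → eval (shift n g) x ≈ x ^ n * eval g x
  eval-shift zero    g x = sym (*-identityˡ _)
  eval-shift (suc n) g x = trans (+-identityˡ _) (trans (*-congˡ (eval-shift n g x)) (sym (*-assoc _ _ _)))

  module _ (P : Carrier) where
    open Congruence coeffRing P

    eval-≈ₘ : ∀ g {a b} → a ≈ₘ b → eval g a ≈ₘ eval g b
    eval-≈ₘ []      a≈ₘb = ≈ₘ-refl
    eval-≈ₘ (c ∷ g) a≈ₘb = +-cong-≈ₘ ≈ₘ-refl (*-cong-≈ₘ a≈ₘb (eval-≈ₘ g a≈ₘb))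

  -- The exponent is passed as its predecessor m, so that p = suc m is nonzero by construction.
  module Inflation (m : ℕ) where

    p : ℕ
    p = suc m

    InXᵖ : Pol → Set
    InXᵖ f = ∀ i → ¬ (p ℕ.∣ i) → f ⟨ i ⟩ ≈ 0#

    inflate : Pol → Pol
    inflate []      = []
    inflate (c ∷ g) = c ∷ shift m (inflate g)

    coeff-inflate-* : ∀ g j → inflate g ⟨ j ℕ.* p ⟩ ≈ g ⟨ j ⟩
    coeff-inflate-* []      j       = refl
    coeff-inflate-* (c ∷ g) zero    = refl
    coeff-inflate-* (c ∷ g) (suc j) =
      trans (reflexive (coeff-shift-+ m (inflate g) (j ℕ.* p))) (coeff-inflate-* g j)

    inflate-InXᵖ : ∀ g → InXᵖ (inflate g)
    inflate-InXᵖ []      i       _      = refl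
    inflate-InXᵖ (c ∷ g) zero    p∤0    = ⊥-elim (p∤0 (divides 0 ≡.refl))
    inflate-InXᵖ (c ∷ g) (suc i) p∤1+i with i ℕ.<? m
    ... | yes i<m = reflexive (coeff-shift-< m (inflate g) i<m)
    ... | no  i≮m with ℕ.m≤n⇒∃[o]m+o≡n (ℕ.≮⇒≥ i≮m)
    ...   | o , ≡.refl = trans (reflexive (coeff-shift-+ m (inflate g) o)) (inflate-InXᵖ g o p∤o)
      where
      p∤o : ¬ (p ℕ.∣ o)
      p∤o (divides q o≡qp) = p∤1+i (divides (suc q) (≡.cong (suc ∘ (m ℕ.+_)) o≡qp))

    InXᵖ-≋ : ∀ {f g} → InXᵖ f → InXᵖ g → (∀ j → f ⟨ j ℕ.* p ⟩ ≈ g ⟨ j ℕ.* p ⟩) → f ≋ g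
    InXᵖ-≋ {f} {g} f∈ g∈ f≈g = coeffwise λ i → pointwise (p ∣? i)
      where
      pointwise : ∀ {i} → Dec (p ℕ.∣ i) → f ⟨ i ⟩ ≈ g ⟨ i ⟩
      pointwise (yes (divides j ≡.refl)) = f≈g j
      pointwise {i} (no p∤i)             = trans (f∈ i p∤i) (sym (g∈ i p∤i))

    inflate-≋ : ∀ {f} g → InXᵖ f → (∀ j → f ⟨ j ℕ.* p ⟩ ≈ g ⟨ j ⟩) → f ≋ inflate g
    inflate-≋ g f∈ f≈g = InXᵖ-≋ f∈ (inflate-InXᵖ g) λ j → trans (f≈g j) (sym (coeff-inflate-* g j))

    inflate-cong : ∀ {g h} → g ≋ h → inflate g ≋ inflate h
    inflate-cong {g} {h} g≋h =
      inflate-≋ h (inflate-InXᵖ g) λ j → trans (coeff-inflate-* g j) (coeff-≈ g≋h j)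

    inflate-⊕ : ∀ g h → inflate (g ⊕ h) ≋ inflate g ⊕ inflate h
    inflate-⊕ g h = ≋-sym (inflate-≋ (g ⊕ h) ig⊕ih∈ λ j →
      trans (coeff-⊕ (inflate g) (inflate h) _)
        (trans (+-cong (coeff-inflate-* g j) (coeff-inflate-* h j)) (sym (coeff-⊕ g h j))))
      where
      ig⊕ih∈ : InXᵖ (inflate g ⊕ inflate h)
      ig⊕ih∈ i p∤i = trans (coeff-⊕ (inflate g) (inflate h) i)
        (trans (+-cong (inflate-InXᵖ g i p∤i) (inflate-InXᵖ h i p∤i)) (+-identityʳ 0#))

    inflate-· : ∀ a g → inflate (a · g) ≋ a · inflate g
    inflate-· a g = ≋-sym (inflate-≋ (a · g) a·ig∈ λ j →
      trans (coeff-· a (inflate g) _) (trans (*-congˡ (coeff-inflate-* g j)) (sym (coeff-· a g j))))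
      where
      a·ig∈ : InXᵖ (a · inflate g)
      a·ig∈ i p∤i = trans (coeff-· a (inflate g) i) (trans (*-congˡ (inflate-InXᵖ g i p∤i)) (zeroʳ a))

    inflate-⊛ : ∀ g h → inflate (g ⊛ h) ≋ inflate g ⊛ inflate h
    inflate-⊛ []      h = ≋-refl
    inflate-⊛ (c ∷ g) h = ≋-trans (inflate-⊕ (c · h) (0# ∷ g ⊛ h))
      (⊕-cong (inflate-· c h) (∷-cong refl
        (≋-trans (shift-cong m (inflate-⊛ g h)) (≋-sym (shift-⊛ m (inflate g) (inflate h))))))

    inflate-𝟙 : inflate 𝟙 ≋ 𝟙
    inflate-𝟙 = ∷-cong refl (shift-[] m)

    deflate : Pol → Pol
    deflate f = applyUpTo (λ j → f ⟨ j ℕ.* p ⟩) (length f)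

    coeff-deflate : ∀ f j → deflate f ⟨ j ⟩ ≈ f ⟨ j ℕ.* p ⟩
    coeff-deflate f j = coeff-applyUpTo _ (length f) j λ |f|≤j →
      reflexive (coeff-≥length f (ℕ.≤-trans |f|≤j (ℕ.m≤m*n j p)))

    deflate-≋ : ∀ f {g} → (∀ j → f ⟨ j ℕ.* p ⟩ ≈ g ⟨ j ⟩) → deflate f ≋ g
    deflate-≋ f f≈g = coeffwise λ j → trans (coeff-deflate f j) (f≈g j)

    deflate-cong : ∀ {f g} → f ≋ g → deflate f ≋ deflate g
    deflate-cong {f} {g} f≋g = deflate-≋ f λ j → trans (coeff-≈ f≋g _) (sym (coeff-deflate g j))

    deflate-⊕ : ∀ f g → deflate (f ⊕ g) ≋ deflate f ⊕ deflate g
    deflate-⊕ f g = deflate-≋ (f ⊕ g) λ j → trans (coeff-⊕ f g _)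
      (sym (trans (coeff-⊕ (deflate f) (deflate g) j) (+-cong (coeff-deflate f j) (coeff-deflate g j))))

    deflate-· : ∀ a f → deflate (a · f) ≋ a · deflate f
    deflate-· a f = deflate-≋ (a · f) λ j → trans (coeff-· a f _)
      (sym (trans (coeff-· a (deflate f) j) (*-congˡ (coeff-deflate f j))))

    deflate-shift : ∀ f → deflate (shift p f) ≋ 0# ∷ deflate f
    deflate-shift f = deflate-≋ (shift p f) λ
      { zero    → refl
      ; (suc j) → trans (reflexive (coeff-shift-+ m f (j ℕ.* p))) (sym (coeff-deflate f j)) }

    deflate-inflate-⊛ : ∀ f g → deflate (inflate f ⊛ g) ≋ f ⊛ deflate g
    deflate-inflate-⊛ []      g = ≋-refl
    deflate-inflate-⊛ (c ∷ f) g = ≋-trans (deflate-⊕ (c · g) (0# ∷ shift m (inflate f) ⊛ g))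
      (⊕-cong (deflate-· c g) (≋-trans (deflate-cong (∷-cong refl (shift-⊛ m (inflate f) g)))
        (≋-trans (deflate-shift (inflate f ⊛ g)) (∷-cong refl (deflate-inflate-⊛ f g)))))

    deflate-𝟙 : deflate 𝟙 ≋ 𝟙
    deflate-𝟙 = deflate-≋ 𝟙 λ { zero → refl ; (suc j) → refl }

    inflate-deflate : ∀ {f} → InXᵖ f → f ≋ inflate (deflate f)
    inflate-deflate {f} f∈ = inflate-≋ (deflate f) f∈ λ j → sym (coeff-deflate f j)

    eval-inflate : ∀ g x → eval (inflate g) x ≈ eval g (x ^ p)
    eval-inflate []      x = refl
    eval-inflate (c ∷ g) x = +-congˡ (trans (*-congˡ (eval-shift m (inflate g) x))
      (trans (sym (*-assoc _ _ _)) (*-congˡ (eval-inflate g x))))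

    inflate-IsUnit : ∀ {u} → IsUnit u → IsUnit (inflate u)
    inflate-IsUnit {u} (v , uv≋1) =
      inflate v , ≋-trans (≋-sym (inflate-⊛ u v)) (≋-trans (inflate-cong uv≋1) inflate-𝟙)

    inflate-IsUnit⁻¹ : ∀ {u} → IsUnit (inflate u) → IsUnit u
    inflate-IsUnit⁻¹ {u} (v , iu·v≋1) =
      deflate v , ≋-trans (≋-sym (deflate-inflate-⊛ u v)) (≋-trans (deflate-cong iu·v≋1) deflate-𝟙)

    deflate-irreducible : ∀ {f} → InXᵖ f → Raw.Irreducible f → Raw.Irreducible (deflate f)
    deflate-irreducible {f} f∈ (f≉0 , f-nonunit , f-split) = g≉0 , g-nonunit , g-split
      where
      g = deflate f
      f≋ig : f ≋ inflate g
      f≋ig = inflate-deflate f∈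
      g≉0 : ¬ RawR.IsZ (PolyR R) g
      g≉0 g≈0 = f≉0 (≋[]⇒All-IsZ (≋-trans f≋ig (inflate-cong (All-IsZ⇒≋[] g≈0))))
      g-nonunit : ¬ Raw.Unit g
      g-nonunit g-unit =
        f-nonunit (IsUnit⇒Unitᵣ {f}
          (IsUnit-resp-≋ (≋-sym f≋ig) (inflate-IsUnit {g} (Unitᵣ⇒IsUnit {g} g-unit))))
      reflect-unit : ∀ u → Raw.Unit (inflate u) → Raw.Unit u
      reflect-unit u iu-unit = IsUnit⇒Unitᵣ {u} (inflate-IsUnit⁻¹ {u} (Unitᵣ⇒IsUnit {inflate u} iu-unit))
      g-split : ∀ a b → g Raw.≈ (a ⊛ b) → Raw.Unit a ⊎ Raw.Unit b
      g-split a b g≈ab with f-split (inflate a) (inflate b)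
                               (≋⇒≈ᵣ (≋-trans f≋ig (≋-trans (inflate-cong (≈ᵣ⇒≋ g≈ab)) (inflate-⊛ a b))))
      ... | inj₁ ia-unit = inj₁ (reflect-unit a ia-unit)
      ... | inj₂ ib-unit = inj₂ (reflect-unit b ib-unit)

module FieldFacts (F : FiniteField) where
  open FiniteField F using (A; _≟_; _⁻¹; inverse; 0≢1; elems; complete; unique; card; isCommutativeRing)

  fieldRing : CommutativeRing 0ℓ 0ℓ
  fieldRing = record { isCommutativeRing = isCommutativeRing }

  open CommutativeRing fieldRing
  open import Algebra.Properties.Ring ring using (+-cancelʳ; +-cancelˡ)
  open import Algebra.Properties.Semiring.Mult semiring using (_×_; ×1-homo-*)
  open import Algebra.Properties.CommutativeSemigroup +-commutativeSemigroup using (interchange)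
  open ≡.≡-Reasoning

  *-integral : ∀ a b → a * b ≡ 0# → a ≡ 0# ⊎ b ≡ 0#
  *-integral a b ab≡0 with a ≟ 0#
  ... | yes a≡0 = inj₁ a≡0
  ... | no  a≢0 = inj₂ (begin
    b                ≡⟨ *-identityˡ b ⟨
    1# * b           ≡⟨ ≡.cong (_* b) (inverse a a≢0) ⟨
    (a * a ⁻¹) * b   ≡⟨ ≡.cong (_* b) (*-comm a (a ⁻¹)) ⟩
    (a ⁻¹ * a) * b   ≡⟨ *-assoc (a ⁻¹) a b ⟩
    a ⁻¹ * (a * b)   ≡⟨ ≡.cong (a ⁻¹ *_) ab≡0 ⟩
    a ⁻¹ * 0#        ≡⟨ zeroʳ (a ⁻¹) ⟩
    0#               ∎)

  *-≢0 : ∀ {a b} → a ≢ 0# → b ≢ 0# → a * b ≢ 0#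
  *-≢0 {a} {b} a≢0 b≢0 ab≡0 with *-integral a b ab≡0
  ... | inj₁ a≡0 = a≢0 a≡0
  ... | inj₂ b≡0 = b≢0 b≡0

  private
    sum : List A → A
    sum = foldr _+_ 0#

    sum-↭ : ∀ {xs ys} → xs ↭ ys → sum xs ≡ sum ys
    sum-↭ xs↭ys = foldr-commMonoid +-isCommutativeMonoid (↭⇒↭ₛ xs↭ys)
      where
      open import Data.List.Relation.Binary.Permutation.Setoid.Properties (≡.setoid A)
        using (foldr-commMonoid)

    sum-map-1+ : ∀ xs → sum (map (1# +_) xs) ≡ length xs × 1# + sum xs
    sum-map-1+ []       = ≡.sym (+-identityˡ 0#)
    sum-map-1+ (x ∷ xs) = ≡.trans (≡.cong ((1# + x) +_) (sum-map-1+ xs)) (interchange 1# x _ _)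

  -- Adding 1 permutes the elements of F, so Σ F = card · 1 + Σ F.
  card×1≡0 : card × 1# ≡ 0#
  card×1≡0 = +-cancelʳ (sum elems) (card × 1#) 0# (begin
    card × 1# + sum elems     ≡⟨ sum-map-1+ elems ⟨
    sum (map (1# +_) elems)   ≡⟨ sum-↭ (map-injective-↭ (+-cancelˡ 1# _ _) unique complete) ⟩
    sum elems                 ≡⟨ +-identityˡ _ ⟨
    0# + sum elems            ∎)

  characteristic : ∀ {p} k → card ≡ p ℕ.^ k → p × 1# ≡ 0#
  characteristic {p} k card≡pᵏ = unpower k (≡.subst (λ n → n × 1# ≡ 0#) card≡pᵏ card×1≡0)
    where
    unpower : ∀ k → (p ℕ.^ k) × 1# ≡ 0# → p × 1# ≡ 0#
    unpower zero    1+0≡0 = ⊥-elim (0≢1 (≡.sym (≡.trans (≡.sym (+-identityʳ 1#)) 1+0≡0)))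
    unpower (suc k) pᵏ⁺¹≡0
      with *-integral (p × 1#) ((p ℕ.^ k) × 1#) (≡.trans (≡.sym (×1-homo-* p (p ℕ.^ k))) pᵏ⁺¹≡0)
    ... | inj₁ p≡0  = p≡0
    ... | inj₂ pᵏ≡0 = unpower k pᵏ≡0

module PolynomialsOverField (F : FiniteField) where
  open FiniteField F using (_⁻¹; inverse)
  open OverField F
  open FieldFacts F
  open CommutativeRing fieldRing
    using (_+_; _*_; -_; 0#; 1#; +-identityʳ; +-identityˡ; -‿inverseʳ; *-assoc; *-comm; *-identityʳ;
           zeroʳ; zeroˡ)
  open Polynomial Fraw (FiniteField.isCommutativeRing F) (λ a≡0 → a≡0) (λ a≡0 → a≡0) public

  -- size f = 1 + deg f for f ≉ 0 and size f = 0 for f ≋ 0, so degT P = size P ∸ 1.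
  size : PolyT → ℕ
  size f = length (norm f)

  norm-≋ : ∀ f → norm f ≋ f
  norm-≋ []      = ≋-refl
  norm-≋ (a ∷ f) with norm f | norm-≋ f
  ... | []    | []≋f with isZero? a
  ...   | yes a≡0 = ≋-sym (∷-≋[] a≡0 (≋-sym []≋f))
  ...   | no  _   = ∷-cong ≡.refl []≋f
  norm-≋ (a ∷ f) | b ∷ r | br≋f = ∷-cong ≡.refl br≋f

  coeff-≥size : ∀ f {i} → size f ≤ i → f ⟨ i ⟩ ≡ 0#
  coeff-≥size f size≤i = ≡.trans (≡.sym (coeff-≈ (norm-≋ f) _)) (coeff-≥length (norm f) size≤i)

  leading≢0 : ∀ f {n} → size f ≡ suc n → f ⟨ n ⟩ ≢ 0#
  leading≢0 []      ()
  leading≢0 (a ∷ f) size≡ with norm f | leading≢0 f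
  leading≢0 (a ∷ f) size≡ | [] | _ with isZero? a
  leading≢0 (a ∷ f) ()       | [] | _ | yes _
  leading≢0 (a ∷ f) {zero}  _ | [] | _ | no a≢0 = a≢0
  leading≢0 (a ∷ f) {suc n} () | [] | _ | no _
  leading≢0 (a ∷ f) ≡.refl  | b ∷ r | ih = ih ≡.refl

  size-≤ : ∀ f n → (∀ i → n ≤ i → f ⟨ i ⟩ ≡ 0#) → size f ≤ n
  size-≤ f n vanish with size f in size≡
  ... | zero  = z≤n
  ... | suc k with suc k ℕ.≤? n
  ...   | yes k<n = k<n
  ...   | no  k≮n = ⊥-elim (leading≢0 f size≡ (vanish k (ℕ.≤-pred (ℕ.≰⇒> k≮n))))

  size≤length : ∀ f → size f ≤ length f
  size≤length f = size-≤ f (length f) λ i → coeff-≥length f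

  size≡0⇒≋[] : ∀ {f} → size f ≡ 0 → f ≋ []
  size≡0⇒≋[] {f} size≡0 = coeffwise λ i → coeff-≥size f (≡.subst (_≤ i) (≡.sym size≡0) z≤n)

  ≋[]⇒size≡0 : ∀ {f} → f ≋ [] → size f ≡ 0
  ≋[]⇒size≡0 {f} f≋[] = ℕ.n≤0⇒n≡0 (size-≤ f 0 λ i _ → coeff-≈ f≋[] i)

  ≉[]⇒0<size : ∀ {f} → ¬ f ≋ [] → 0 < size f
  ≉[]⇒0<size {f} f≉[] with size f in size≡
  ... | zero  = ⊥-elim (f≉[] (size≡0⇒≋[] size≡))
  ... | suc _ = s≤s z≤n

  ≋[]? : ∀ f → Dec (f ≋ [])
  ≋[]? f with size f ℕ.≟ 0
  ... | yes size≡0 = yes (size≡0⇒≋[] size≡0)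
  ... | no  size≢0 = no (size≢0 ∘ ≋[]⇒size≡0)

  coeff-⊛-top : ∀ s g a b → (∀ i → a < i → s ⟨ i ⟩ ≡ 0#) → (∀ j → b < j → g ⟨ j ⟩ ≡ 0#) →
                (s ⊛ g) ⟨ a ℕ.+ b ⟩ ≡ s ⟨ a ⟩ * g ⟨ b ⟩
  coeff-⊛-top []      g a       b _ _ = ≡.sym (zeroˡ _)
  coeff-⊛-top (c ∷ s) g zero    b s-top _ = begin
    (c · g ⊕ (0# ∷ s ⊛ g)) ⟨ b ⟩      ≡⟨ coeff-⊕ (c · g) (0# ∷ s ⊛ g) b ⟩
    (c · g) ⟨ b ⟩ + (0# ∷ s ⊛ g) ⟨ b ⟩ ≡⟨ ≡.cong ((c · g) ⟨ b ⟩ +_) (coeff-≈ 0∷sg≋[] b) ⟩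
    (c · g) ⟨ b ⟩ + 0#                ≡⟨ +-identityʳ _ ⟩
    (c · g) ⟨ b ⟩                     ≡⟨ coeff-· c g b ⟩
    c * g ⟨ b ⟩                       ∎
    where
    open ≡.≡-Reasoning
    0∷sg≋[] : 0# ∷ s ⊛ g ≋ []
    0∷sg≋[] = ∷-≋[] ≡.refl (⊛-congˡ {s} {[]} g (coeffwise λ i → s-top (suc i) (s≤s z≤n)))
  coeff-⊛-top (c ∷ s) g (suc a) b s-top g-top = begin
    (c · g ⊕ (0# ∷ s ⊛ g)) ⟨ suc (a ℕ.+ b) ⟩  ≡⟨ coeff-⊕ (c · g) (0# ∷ s ⊛ g) _ ⟩
    (c · g) ⟨ suc (a ℕ.+ b) ⟩ + (s ⊛ g) ⟨ a ℕ.+ b ⟩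
        ≡⟨ ≡.cong₂ _+_ cg-vanishes (coeff-⊛-top s g a b (λ i a<i → s-top (suc i) (s≤s a<i)) g-top) ⟩
    0# + s ⟨ a ⟩ * g ⟨ b ⟩                   ≡⟨ +-identityˡ _ ⟩
    s ⟨ a ⟩ * g ⟨ b ⟩                        ∎
    where
    open ≡.≡-Reasoning
    cg-vanishes : (c · g) ⟨ suc (a ℕ.+ b) ⟩ ≡ 0#
    cg-vanishes = ≡.trans (coeff-· c g _) (≡.trans (≡.cong (c *_) (g-top _ (s≤s (ℕ.m≤n+m b a)))) (zeroʳ c))

  open import Algebra.Properties.Semiring.Divisibility (CommutativeRing.semiring polyRing)
    using (_∣_; _∤_; _,_)

  ∣∧size<⇒≋[] : ∀ {P r} → P ∣ r → size r < size P → r ≋ []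
  ∣∧size<⇒≋[] {P} {r} (q , qP≋r) r<P with ≋[]? q
  ... | yes q≋[] = ≋-trans (≋-sym qP≋r) (⊛-congˡ P q≋[])
  ... | no  q≉[] with size q in size-q | size P in size-P
  ...   | zero  | _     = ⊥-elim (q≉[] (size≡0⇒≋[] size-q))
  ...   | suc a | zero  = ⊥-elim (ℕ.n≮0 r<P)
  ...   | suc a | suc b = ⊥-elim (*-≢0 (leading≢0 q size-q) (leading≢0 P size-P) (begin
    q ⟨ a ⟩ * P ⟨ b ⟩      ≡⟨ coeff-⊛-top q P a b (above q size-q) (above P size-P) ⟨
    (q ⊛ P) ⟨ a ℕ.+ b ⟩    ≡⟨ coeff-≈ qP≋r _ ⟩
    r ⟨ a ℕ.+ b ⟩          ≡⟨ coeff-≥size r (ℕ.≤-trans (ℕ.≤-pred r<P) (ℕ.m≤n+m b a)) ⟩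
    0#                     ∎))
    where
    open ≡.≡-Reasoning
    above : ∀ f {n} → size f ≡ suc n → ∀ i → n < i → f ⟨ i ⟩ ≡ 0#
    above f size≡ i n<i = coeff-≥size f (≡.subst (_≤ i) (≡.sym size≡) n<i)

  private
    -- The reduction step of remFuel, written in the notation above (it is the same term).
    step : PolyT → PolyT → PolyT
    step a′ P′ = a′ ⊕ ⊝ shift (length a′ ∸ length P′) ((lastOr0 a′ * lastOr0 P′ ⁻¹) · P′)

    lastOr0-coeff : ∀ l → lastOr0 l ≡ l ⟨ length l ∸ 1 ⟩
    lastOr0-coeff []          = ≡.refl
    lastOr0-coeff (a ∷ [])    = ≡.refl
    lastOr0-coeff (a ∷ b ∷ l) = lastOr0-coeff (b ∷ l)

    size-step : ∀ x xs h t → lastOr0 (h ∷ t) ≢ 0# → length t ≤ length xs →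
                size (step (x ∷ xs) (h ∷ t)) < suc (length xs)
    size-step x xs h t lead≢0 t≤xs = s≤s (size-≤ (step a′ P′) (length xs) vanish)
      where
      open ≡.≡-Reasoning
      a′ = x ∷ xs
      P′ = h ∷ t
      d  = length xs ∸ length t
      c  = lastOr0 a′ * lastOr0 P′ ⁻¹

      d+t≤ : ∀ {i} → length xs ≤ i → d ℕ.+ length t ≤ i
      d+t≤ = ≡.subst (_≤ _) (≡.sym (ℕ.m∸n+n≡m t≤xs))

      coeff-step : ∀ j → step a′ P′ ⟨ d ℕ.+ j ⟩ ≡ a′ ⟨ d ℕ.+ j ⟩ + - (c * P′ ⟨ j ⟩)
      coeff-step j = begin
        step a′ P′ ⟨ d ℕ.+ j ⟩                        ≡⟨ coeff-⊕ a′ (⊝ shift d (c · P′)) (d ℕ.+ j) ⟩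
        a′ ⟨ d ℕ.+ j ⟩ + (⊝ shift d (c · P′)) ⟨ d ℕ.+ j ⟩
          ≡⟨ ≡.cong (a′ ⟨ d ℕ.+ j ⟩ +_) (coeff-⊝ (shift d (c · P′)) (d ℕ.+ j)) ⟩
        a′ ⟨ d ℕ.+ j ⟩ + - shift d (c · P′) ⟨ d ℕ.+ j ⟩
          ≡⟨ ≡.cong (λ z → a′ ⟨ d ℕ.+ j ⟩ + - z) (≡.trans (coeff-shift-+ d (c · P′) j) (coeff-· c P′ j)) ⟩
        a′ ⟨ d ℕ.+ j ⟩ + - (c * P′ ⟨ j ⟩)             ∎

      c*lead≡ : c * lastOr0 P′ ≡ lastOr0 a′
      c*lead≡ = begin
        (lastOr0 a′ * lastOr0 P′ ⁻¹) * lastOr0 P′  ≡⟨ *-assoc _ _ _ ⟩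
        lastOr0 a′ * (lastOr0 P′ ⁻¹ * lastOr0 P′)
          ≡⟨ ≡.cong (lastOr0 a′ *_) (≡.trans (*-comm _ _) (inverse _ lead≢0)) ⟩
        lastOr0 a′ * 1#                            ≡⟨ *-identityʳ _ ⟩
        lastOr0 a′                                 ∎

      leading-cancels : step a′ P′ ⟨ d ℕ.+ length t ⟩ ≡ 0#
      leading-cancels = begin
        step a′ P′ ⟨ d ℕ.+ length t ⟩                   ≡⟨ coeff-step (length t) ⟩
        a′ ⟨ d ℕ.+ length t ⟩ + - (c * P′ ⟨ length t ⟩)
          ≡⟨ ≡.cong₂ (λ u v → u + - (c * v))
               (≡.trans (≡.cong (a′ ⟨_⟩) (ℕ.m∸n+n≡m t≤xs)) (≡.sym (lastOr0-coeff a′)))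
               (≡.sym (lastOr0-coeff P′)) ⟩
        lastOr0 a′ + - (c * lastOr0 P′)                 ≡⟨ ≡.cong (λ z → lastOr0 a′ + - z) c*lead≡ ⟩
        lastOr0 a′ + - lastOr0 a′                       ≡⟨ -‿inverseʳ _ ⟩
        0#                                              ∎

      beyond-vanishes : ∀ j → length t < j → step a′ P′ ⟨ d ℕ.+ j ⟩ ≡ 0#
      beyond-vanishes j t<j = begin
        step a′ P′ ⟨ d ℕ.+ j ⟩             ≡⟨ coeff-step j ⟩
        a′ ⟨ d ℕ.+ j ⟩ + - (c * P′ ⟨ j ⟩)
          ≡⟨ ≡.cong₂ (λ u v → u + - (c * v)) (coeff-≥length a′ a′<d+j) (coeff-≥length P′ t<j) ⟩
        0# + - (c * 0#)                    ≡⟨ ≡.cong (λ z → 0# + - z) (zeroʳ c) ⟩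
        0# + - 0#                          ≡⟨ -‿inverseʳ 0# ⟩
        0#                                 ∎
        where
        a′<d+j : length a′ ≤ d ℕ.+ j
        a′<d+j = ≡.subst (_≤ d ℕ.+ j) (≡.trans (ℕ.+-suc d (length t)) (≡.cong suc (ℕ.m∸n+n≡m t≤xs)))
                         (ℕ.+-monoʳ-≤ d t<j)

      vanish : ∀ i → length xs ≤ i → step a′ P′ ⟨ i ⟩ ≡ 0#
      vanish i xs≤i with ℕ.m≤n⇒∃[o]m+o≡n (ℕ.m+n≤o⇒m≤o d (d+t≤ xs≤i))
      ... | j , ≡.refl with ℕ.m≤n⇒m<n∨m≡n (ℕ.+-cancelˡ-≤ d (length t) j (d+t≤ xs≤i))
      ...   | inj₁ t<j    = beyond-vanishes j t<j
      ...   | inj₂ ≡.refl = leading-cancels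

  norm≡⇒≋ : ∀ {f g} → norm f ≡ g → f ≋ g
  norm≡⇒≋ {f} norm-f = ≡.subst (f ≋_) norm-f (≋-sym (norm-≋ f))

  module Modulo (P : PolyT) where
    open Congruence polyRing P public

    private
      step-≈ₘ : ∀ a′ P′ → P′ ≋ P → a′ ≈ₘ step a′ P′
      step-≈ₘ a′ P′ P′≋P =
        ≈ₘ-trans (x≈ₘx-sP a′ (shift d (c ∷ []))) (≈⇒≈ₘ (⊕-cong ≋-refl (⊝-cong monomial·P)))
        where
        d = length a′ ∸ length P′
        c = lastOr0 a′ * lastOr0 P′ ⁻¹
        monomial·P : shift d (c ∷ []) ⊛ P ≋ shift d (c · P′)
        monomial·P = ≋-trans (shift-⊛ d (c ∷ []) P)
          (shift-cong d (≋-trans (⊕-cong ≋-refl (∷-≋[] ≡.refl ≋-refl))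
            (≋-trans (⊕-identityʳ (c · P)) (·-cong ≡.refl (≋-sym P′≋P)))))

    remFuel-≈ₘ : ∀ n a → a ≈ₘ remFuel n a P
    remFuel-≈ₘ zero    a = ≈⇒≈ₘ (≋-sym (norm-≋ a))
    remFuel-≈ₘ (suc n) a with norm a in norm-a | norm P in norm-P
    ... | a′ | []          = ≈⇒≈ₘ (norm≡⇒≋ norm-a)
    ... | a′ | P′@(_ ∷ _) with length a′ ℕ.<ᵇ length P′
    ...   | true  = ≈⇒≈ₘ (norm≡⇒≋ norm-a)
    ...   | false = ≈ₘ-trans (≈⇒≈ₘ (norm≡⇒≋ norm-a))
                      (≈ₘ-trans (step-≈ₘ a′ P′ (≋-sym (norm≡⇒≋ norm-P))) (remFuel-≈ₘ n (step a′ P′)))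

    size-remFuel : ∀ n a → size a ≤ n → 0 < size P → size (remFuel (suc n) a P) < size P
    size-remFuel n a a≤n 0<P with norm a in norm-a | norm P in norm-P
    ... | a′     | []    = ⊥-elim (ℕ.n≮0 0<P)
    ... | []     | h ∷ t = s≤s z≤n
    ... | x ∷ xs | h ∷ t with length xs ℕ.<ᵇ length t in xs<t
    ...   | true  = ℕ.≤-<-trans (size≤length (x ∷ xs)) (s≤s (ℕ.<ᵇ⇒< _ _ (≡.subst T (≡.sym xs<t) _)))
    ...   | false with a≤n
    ...     | s≤s {n = n′} xs≤n′ = ≡.subst (size (remFuel (suc n′) a″ P) <_) size-P
                                     (size-remFuel n′ a″ a″≤n′ (≡.subst (0 <_) (≡.sym size-P) (s≤s z≤n)))
      where
      a″ = step (x ∷ xs) (h ∷ t)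
      size-P : size P ≡ suc (length t)
      size-P = ≡.cong length norm-P
      t≤xs : length t ≤ length xs
      t≤xs = ℕ.≮⇒≥ (λ xs<t′ → ≡.subst T xs<t (ℕ.<⇒<ᵇ xs<t′))
      lead≢0 : lastOr0 (h ∷ t) ≢ 0#
      lead≢0 lead≡0 = leading≢0 P size-P
        (≡.trans (coeff-≈ (norm≡⇒≋ {P} norm-P) (length t)) (≡.trans (≡.sym (lastOr0-coeff (h ∷ t))) lead≡0))
      a″≤n′ : size a″ ≤ n′
      a″≤n′ = ℕ.≤-trans (ℕ.≤-pred (size-step x xs h t lead≢0 t≤xs)) xs≤n′

    modT-≈ₘ : ∀ a → a ≈ₘ a modT P
    modT-≈ₘ a = remFuel-≈ₘ (suc (length a)) a

    size-modT : ∀ a → 0 < size P → size (a modT P) < size P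
    size-modT a = size-remFuel (length a) a (size≤length a)

    ∣⇒modT≋[] : ¬ P ≋ [] → ∀ {a} → P ∣ a → a modT P ≋ []
    ∣⇒modT≋[] P≉[] {a} P∣a = ∣∧size<⇒≋[] (≈ₘ0⇒∣ (≈ₘ-trans (≈ₘ-sym (modT-≈ₘ a)) (∣⇒≈ₘ0 P∣a)))
                                          (size-modT a (≉[]⇒0<size P≉[]))

    modT≋[]⇒∣ : ∀ {a} → a modT P ≋ [] → P ∣ a
    modT≋[]⇒∣ {a} r≋[] = ≈ₘ0⇒∣ (≈ₘ-trans (modT-≈ₘ a) (≈⇒≈ₘ r≋[]))

    ∣? : ¬ P ≋ [] → ∀ a → Dec (P ∣ a)
    ∣? P≉[] a with ≋[]? (a modT P)
    ... | yes r≋[] = yes (modT≋[]⇒∣ r≋[])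
    ... | no  r≉[] = no (r≉[] ∘ ∣⇒modT≋[] P≉[])

  open import Algebra.Definitions.RawSemiring (Semiring.rawSemiring (CommutativeRing.semiring polyRing))
    using (Prime; mkPrime; Irreducible; module Irreducible)

  irreducible⇒prime : ∀ {P} → Irreducible P → ¬ P ≋ [] → Prime P
  irreducible⇒prime {P} P-irr P≉[] = mkPrime P≉[] (Irreducible.p∤1 P-irr) split-∣
    where
    open Modulo P
    open import Relation.Binary.Reasoning.Setoid ≈ₘ-setoid

    -- Euclid: dividing P by a gives P = s a + r with size r < size a and P ∣ r b; by induction
    -- P ∣ r, so r ≋ 0 by size, and irreducibility of P = s a makes s or a a unit.
    euclid : ∀ {b} n a → size a ≤ n → size a < size P → P ∤ b → P ∣ a ⊛ b → P ∣ a
    euclid zero    a a≤0 _ _ _ = ≈ₘ0⇒∣ (≈⇒≈ₘ (size≡0⇒≋[] (ℕ.n≤0⇒n≡0 a≤0)))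
    euclid {b} (suc n) a a≤1+n a<P P∤b P∣ab with ≋[]? a | Modulo.modT-≈ₘ a P
    ... | yes a≋[] | _ = ≈ₘ0⇒∣ (≈⇒≈ₘ a≋[])
    ... | no  a≉[] | s , P≋r+sa = split (Irreducible.split-∣1 P-irr P≋sa)
      where
      r = P modT a
      r<a : size r < size a
      r<a = Modulo.size-modT a P (≉[]⇒0<size a≉[])
      rb≈ₘ0 : r ⊛ b ≈ₘ []
      rb≈ₘ0 = begin
        r ⊛ b                    ≈⟨ ≈⇒≈ₘ (≋-sym (≋-trans (⊕-cong ≋-refl (⊛-zeroʳ s)) (⊕-identityʳ _))) ⟩
        r ⊛ b ⊕ s ⊛ []           ≈⟨ +-cong-≈ₘ (≈ₘ-refl {r ⊛ b}) (*-cong-≈ₘ (≈ₘ-refl {s}) (∣⇒≈ₘ0 P∣ab)) ⟨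
        r ⊛ b ⊕ s ⊛ (a ⊛ b)      ≈⟨ ≈⇒≈ₘ (≋-trans (⊕-cong ≋-refl (≋-sym (⊛-assoc s a b)))
                                                  (≋-sym (⊛-distribʳ r (s ⊛ a) b))) ⟩
        (r ⊕ s ⊛ a) ⊛ b          ≈⟨ ≈⇒≈ₘ (⊛-congˡ b (≋-sym P≋r+sa)) ⟩
        P ⊛ b                    ≈⟨ *-cong-≈ₘ (∣⇒≈ₘ0 (𝟙 , ⊛-identityˡ P)) ≈ₘ-refl ⟩
        [] ⊛ b                   ∎
      P∣r : P ∣ r
      P∣r = euclid n r (ℕ.≤-pred (ℕ.<-≤-trans r<a a≤1+n)) (ℕ.<-trans r<a a<P) P∤b (≈ₘ0⇒∣ rb≈ₘ0)
      P≋sa : P ≋ s ⊛ a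
      P≋sa = ≋-trans P≋r+sa (⊕-cong (∣∧size<⇒≋[] P∣r (ℕ.<-trans r<a a<P)) ≋-refl)
      split : s ∣ 𝟙 ⊎ a ∣ 𝟙 → P ∣ a
      split (inj₁ (u , us≋1)) = u , (≋-trans (⊛-congʳ u P≋sa) (≋-trans (≋-sym (⊛-assoc u s a))
                                      (≋-trans (⊛-congˡ a us≋1) (⊛-identityˡ a))))
      split (inj₂ (v , va≋1)) = ⊥-elim (P∤b (≈ₘ0⇒∣ (begin
        b                ≈⟨ ≈⇒≈ₘ (≋-trans (≋-sym (⊛-identityˡ b)) (⊛-congˡ b (≋-sym va≋1))) ⟩
        (v ⊛ a) ⊛ b      ≈⟨ ≈⇒≈ₘ (⊛-assoc v a b) ⟩
        v ⊛ (a ⊛ b)      ≈⟨ *-cong-≈ₘ (≈ₘ-refl {v}) (∣⇒≈ₘ0 P∣ab) ⟩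
        v ⊛ []           ≈⟨ ≈⇒≈ₘ (⊛-zeroʳ v) ⟩
        []               ∎)))

    split-∣ : ∀ {x y} → P ∣ x ⊛ y → P ∣ x ⊎ P ∣ y
    split-∣ {x} {y} P∣xy with ∣? P≉[] y
    ... | yes P∣y = inj₂ P∣y
    ... | no  P∤y = inj₁ (≈ₘ0⇒∣ (≈ₘ-trans (modT-≈ₘ x) (∣⇒≈ₘ0 P∣x₀)))
      where
      x₀ = x modT P
      P∣x₀ : P ∣ x₀
      P∣x₀ = euclid (size x₀) x₀ ℕ.≤-refl (size-modT x (≉[]⇒0<size P≉[])) P∤y
               (≈ₘ0⇒∣ (≈ₘ-trans (*-cong-≈ₘ (≈ₘ-sym (modT-≈ₘ x)) ≈ₘ-refl) (∣⇒≈ₘ0 P∣xy)))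

  IrreducibleT⇒Prime : ∀ {P} → IrreducibleT P → Prime P
  IrreducibleT⇒Prime P-irr = irreducible⇒prime (Irreducibleᵣ⇒Irreducible P-irr) (Irreducibleᵣ⇒≉[] P-irr)

module Counting (F : FiniteField) where
  open FiniteField F using (A; elems; complete; unique)
  open OverField F
  open FieldFacts F
  open PolynomialsOverField F
  open CommutativeRing fieldRing using (0#; 1#; _+_; -_; -‿inverseʳ)
  module X = Polynomial FT ⊕-⊛-isCommutativeRing All-IsZ⇒≋[] ≋[]⇒All-IsZ

  evalX≡eval : ∀ g Q → evalX g Q ≡ X.eval g Q
  evalX≡eval []      Q = ≡.refl
  evalX≡eval (c ∷ g) Q = ≡.cong (λ e → c ⊕ Q ⊛ e) (evalX≡eval g Q)

  allVecs-complete : ∀ n (v : Vec A n) → v ∈ allVecs n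
  allVecs-complete zero    Vec.[]       = here ≡.refl
  allVecs-complete (suc n) (a Vec.∷ v) =
    ∈-concat⁺′ (∈-map⁺ (a Vec.∷_) (allVecs-complete n v))
               (∈-map⁺ (λ b → map (b Vec.∷_) (allVecs n)) (complete a))

  allVecs-unique : ∀ n → Unique (allVecs n)
  allVecs-unique zero    = [] ∷ []
  allVecs-unique (suc n) = prefixed-unique elems unique
    where
    prefixed : List A → List (Vec A (suc n))
    prefixed = concatMap (λ a → map (a Vec.∷_) (allVecs n))
    head≡ : ∀ {v a} → v ∈ map (a Vec.∷_) (allVecs n) → Vec.head v ≡ a
    head≡ v∈a∷ with ∈-map⁻ _ v∈a∷
    ... | _ , _ , ≡.refl = ≡.refl
    head∈ : ∀ {v} as → v ∈ prefixed as → Vec.head v ∈ as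
    head∈ as v∈ = Any.map head≡ (∈-concatMap⁻ _ {xs = as} v∈)
    prefixed-unique : ∀ as → Unique as → Unique (prefixed as)
    prefixed-unique []       _              = []
    prefixed-unique (a ∷ as) (a∉as ∷ u-as) =
      Unique.++⁺ (Unique.map⁺ Vec.∷-injectiveʳ (allVecs-unique n)) (prefixed-unique as u-as)
        λ (v∈a∷ , v∈as) → All.lookup a∉as (≡.subst (_∈ as) (head≡ v∈a∷) (head∈ as v∈as)) ≡.refl

  pad : (n : ℕ) → PolyT → Vec A n
  pad zero    f       = Vec.[]
  pad (suc n) []      = 0# Vec.∷ pad n []
  pad (suc n) (a ∷ f) = a Vec.∷ pad n f

  toList-pad : ∀ n f → (∀ i → n ≤ i → f ⟨ i ⟩ ≡ 0#) → toList (pad n f) ≋ f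
  toList-pad zero    f       vanish = coeffwise λ i → ≡.sym (vanish i z≤n)
  toList-pad (suc n) []      vanish = ∷-≋[] ≡.refl (toList-pad n [] λ _ _ → ≡.refl)
  toList-pad (suc n) (a ∷ f) vanish = ∷-cong ≡.refl (toList-pad n f λ i n≤i → vanish (suc i) (s≤s n≤i))

  toList-injective : ∀ {n} (u v : Vec A n) → toList u ≋ toList v → u ≡ v
  toList-injective Vec.[]       Vec.[]       _     = ≡.refl
  toList-injective (a Vec.∷ u) (b Vec.∷ v) au≋bv =
    ≡.cong₂ Vec._∷_ (coeff-≈ au≋bv 0) (toList-injective u v (∷-cancel au≋bv))

  open import Algebra.Properties.Semiring.Divisibility (CommutativeRing.semiring polyRing) using (_∣_)
  open import Algebra.Properties.Semiring.Exp (CommutativeRing.semiring polyRing) using (_^_; ^-congˡ)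
  open import Algebra.Properties.Semiring.Mult (CommutativeRing.semiring polyRing)
    using () renaming (_×_ to _×ₚ_)
  open import Algebra.Properties.Semiring.Mult (CommutativeRing.semiring fieldRing) using (_×_)
  open import Algebra.Properties.Group (CommutativeRing.+-group polyRing) using (x∙y⁻¹≈ε⇒x≈y)

  ×ₚ𝟙 : ∀ n → n ×ₚ 𝟙 ≋ (n × 1#) ∷ []
  ×ₚ𝟙 zero    = ≋-sym (∷-≋[] ≡.refl ≋-refl)
  ×ₚ𝟙 (suc n) = ⊕-cong (≋-refl {𝟙}) (×ₚ𝟙 n)

  module Residues (P : PolyT) (P-irr : IrreducibleT P) where
    open Modulo P
    open import Relation.Binary.Reasoning.Setoid ≈ₘ-setoid

    n : ℕ
    n = degT P

    size-P : size P ≡ suc n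
    size-P with size P | ≉[]⇒0<size (Irreducibleᵣ⇒≉[] P-irr)
    ... | suc _ | _ = ≡.refl

    reduce : PolyT → Vec A n
    reduce a = pad n (a modT P)

    ≈ₘ-reduce : ∀ a → a ≈ₘ toList (reduce a)
    ≈ₘ-reduce a = ≈ₘ-trans (modT-≈ₘ a) (≈⇒≈ₘ (≋-sym (toList-pad n (a modT P) λ i n≤i →
      coeff-≥size (a modT P) (ℕ.≤-trans r≤n n≤i))))
      where
      r≤n : size (a modT P) ≤ n
      r≤n = ℕ.≤-pred (≡.subst (size (a modT P) <_) size-P
                              (size-modT a (≡.subst (0 <_) (≡.sym size-P) (s≤s z≤n))))

    residue-injective : ∀ {u v : Vec A n} → P ∣ toList u ⊕ ⊝ toList v → u ≡ v
    residue-injective {u} {v} P∣u-v = toList-injective u v (x∙y⁻¹≈ε⇒x≈y _ _ (∣∧size<⇒≋[] P∣u-v u-v<P))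
      where
      beyond : ∀ (w : Vec A n) {i} → n ≤ i → toList w ⟨ i ⟩ ≡ 0#
      beyond w n≤i = coeff-≥length (toList w) (≡.subst (_≤ _) (≡.sym (Vec.length-toList w)) n≤i)
      vanish : ∀ i → n ≤ i → (toList u ⊕ ⊝ toList v) ⟨ i ⟩ ≡ 0#
      vanish i n≤i = ≡.trans (coeff-⊕ (toList u) (⊝ toList v) i)
        (≡.trans (≡.cong₂ _+_ (beyond u n≤i) (≡.trans (coeff-⊝ (toList v) i) (≡.cong -_ (beyond v n≤i))))
                 (-‿inverseʳ 0#))
      u-v<P : size (toList u ⊕ ⊝ toList v) < size P
      u-v<P = ≡.subst (size (toList u ⊕ ⊝ toList v) <_) (≡.sym size-P)
                      (s≤s (size-≤ (toList u ⊕ ⊝ toList v) n vanish))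

    root⇒∣ : ∀ g (Q : Vec A n) → All (_≡ 0#) (evalX g (toList Q) modT P) → P ∣ X.eval g (toList Q)
    root⇒∣ g Q r≡0 = ≡.subst (P ∣_) (evalX≡eval g (toList Q)) (modT≋[]⇒∣ (All-IsZ⇒≋[] r≡0))

    ∣⇒root : ∀ g (Q : Vec A n) → P ∣ X.eval g (toList Q) → All (_≡ 0#) (evalX g (toList Q) modT P)
    ∣⇒root g Q P∣gQ = ≋[]⇒All-IsZ (∣⇒modT≋[] (Irreducibleᵣ⇒≉[] P-irr)
                                     (≡.subst (P ∣_) (≡.sym (evalX≡eval g (toList Q))) P∣gQ))

    module Frobenius (m : ℕ) (p-prime : ℕ.Prime (suc m)) (k : ℕ) (card≡pᵏ : FiniteField.card F ≡ suc m ℕ.^ k)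
      where
      open X.Inflation m using (p; InXᵖ; deflate; inflate-deflate; eval-inflate)

      frobenius : Vec A n → Vec A n
      frobenius Q = reduce (toList Q ^ p)

      frobenius-injective : ∀ {Q R} → frobenius Q ≡ frobenius R → Q ≡ R
      frobenius-injective {Q} {R} φQ≡φR =
        residue-injective
          (prime∣^⇒∣ (CommutativeRing.semiring polyRing) m (IrreducibleT⇒Prime P-irr) (≈ₘ0⇒∣ [q-r]ᵖ≈ₘ0))
        where
        q = toList Q
        r = toList R
        polySemiring = CommutativeRing.commutativeSemiring polyRing
        char : p ×ₚ 𝟙 ≋ []
        char = ≋-trans (×ₚ𝟙 p) (∷-≋[] (characteristic k card≡pᵏ) ≋-refl)
        q-r+r≋q : q ⊕ ⊝ r ⊕ r ≋ q
        q-r+r≋q = ≋-trans (⊕-assoc q (⊝ r) r) (≋-trans (⊕-cong (≋-refl {q}) (⊕-inverseˡ r)) (⊕-identityʳ q))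
        [q-r]ᵖ≈ₘ0 : (q ⊕ ⊝ r) ^ p ≈ₘ []
        [q-r]ᵖ≈ₘ0 = +-cancelʳ-≈ₘ (r ^ p) (begin
          (q ⊕ ⊝ r) ^ p ⊕ r ^ p  ≈⟨ ≈⇒≈ₘ (freshmans-dream polySemiring p-prime char (q ⊕ ⊝ r) r) ⟨
          (q ⊕ ⊝ r ⊕ r) ^ p      ≈⟨ ≈⇒≈ₘ (^-congˡ p q-r+r≋q) ⟩
          q ^ p                  ≈⟨ ≈ₘ-reduce (q ^ p) ⟩
          toList (frobenius Q)   ≡⟨ ≡.cong toList φQ≡φR ⟩
          toList (frobenius R)   ≈⟨ ≈ₘ-reduce (r ^ p) ⟨
          r ^ p                  ≈⟨ ≈ₘ-refl ⟩
          [] ⊕ r ^ p             ∎)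

      ρ-deflate : ∀ {f} → InXᵖ f → ρ f P ≡ ρ (deflate f) P
      ρ-deflate {f} f∈ =
        length-filter-injective _ _ frobenius-injective (allVecs-unique n) (allVecs-complete n)
        (λ Q root → ∣⇒root g (frobenius Q) (≈ₘ0⇒∣ (≈ₘ-trans (≈ₘ-sym (f≈ₘg∘φ Q)) (∣⇒≈ₘ0 (root⇒∣ f Q root)))))
        (λ Q root → ∣⇒root f Q (≈ₘ0⇒∣ (≈ₘ-trans (f≈ₘg∘φ Q) (∣⇒≈ₘ0 (root⇒∣ g (frobenius Q) root)))))
        where
        g = deflate f
        f≈ₘg∘φ : ∀ (Q : Vec A n) → X.eval f (toList Q) ≈ₘ X.eval g (toList (frobenius Q))
        f≈ₘg∘φ Q = ≈ₘ-trans
          (≈⇒≈ₘ (≋-trans (X.eval-cong (toList Q) (inflate-deflate {f} f∈)) (eval-inflate g (toList Q))))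
          (X.eval-≈ₘ P g (≈ₘ-reduce (toList Q ^ p)))

open import Data.Nat using (_^_)
open import Data.Nat.Primality using (Prime)
open import Data.Product using (_×_)

module Separable (F : FiniteField) where
  open OverField F
  open PolynomialsOverField F using (All-IsZ⇒≋[]; ≋[]⇒All-IsZ; ≋-trans; ≋-sym)
  open Counting F using (module X; module Residues)

  InXp? : ∀ p f → Dec (InXp p f)
  InXp? p f with ℕ.allUpTo? (λ i → ¬? (p ∣? i) →-dec isZeroT? (coeff FT f i)) (length f)
  ... | no  ¬below = no λ f∈ → ¬below λ {i} _ → f∈ i
  ... | yes below  = yes λ i → on i (i ℕ.<? length f)
    where
    on : ∀ i → Dec (i < length f) → ¬ (p ℕ.∣ i) → RawR.IsZ FT (coeff FT f i)
    on i (yes i<f) = below i<f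
    on i (no  i≮f) _ = ≡.subst (RawR.IsZ FT) (≡.sym (X.coeff-≥length f (ℕ.≮⇒≥ i≮f))) []

  module _ (m : ℕ) (p-prime : Prime (suc m)) (k : ℕ) (card≡pᵏ : FiniteField.card F ≡ suc m ^ k) where
    open X.Inflation m using (p; InXᵖ; deflate; coeff-deflate; deflate-irreducible)

    SeparableModel : PolyTX → Set
    SeparableModel f = ∃ λ h → IrreducibleTX h × ¬ InXp p h × (∀ P → IrreducibleT P → ρ f P ≡ ρ h P)

    SeparableModel-deflate : ∀ {f} → InXᵖ f → SeparableModel (deflate f) → SeparableModel f
    SeparableModel-deflate {f} f∈ (h , h-irr , h∉ , ρg≡ρh) = h , h-irr , h∉ , λ P P-irr →
      ≡.trans (Residues.Frobenius.ρ-deflate P P-irr m p-prime k card≡pᵏ {f} f∈) (ρg≡ρh P P-irr)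

    -- Induction on the position i ≥ 1 of a nonzero coefficient: deflation moves it from j p to j.
    Descent : ℕ → Set
    Descent i = ∀ f → 1 ≤ i → ¬ RawR.IsZ FT (coeff FT f i) → IrreducibleTX f → SeparableModel f

    separable-model : ∀ i → Descent i
    separable-model = <-rec Descent descend
      where
      descend : ∀ i → <-Rec Descent i → Descent i
      descend i rec f 1≤i fᵢ≉0 f-irr with InXp? p f
      ... | no  f∉ = f , f-irr , f∉ , λ _ _ → ≡.refl
      ... | yes f∈ with p ∣? i
      ...   | no  p∤i = ⊥-elim (fᵢ≉0 (f∈ i p∤i))
      ...   | yes (divides zero    ≡.refl) = ⊥-elim (ℕ.<⇒≱ 1≤i z≤n)
      ...   | yes (divides (suc j) ≡.refl) = SeparableModel-deflate {f} f∈′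
                (rec j<i (deflate f) (s≤s z≤n) gⱼ≉0 (deflate-irreducible f∈′ f-irr))
        where
        j<i : suc j < suc j ℕ.* p
        j<i = ℕ.m<m*n (suc j) p (nonTrivial⇒n>1 p {{ℕ.prime⇒nonTrivial p-prime}})
        f∈′ : InXᵖ f
        f∈′ i p∤i = All-IsZ⇒≋[] (f∈ i p∤i)
        gⱼ≉0 : ¬ RawR.IsZ FT (coeff FT (deflate f) (suc j))
        gⱼ≉0 gⱼ≈0 = fᵢ≉0 (≋[]⇒All-IsZ (≋-trans (≋-sym (coeff-deflate f (suc j))) (All-IsZ⇒≋[] gⱼ≈0)))

lemma2p10 : (F : FiniteField) (p : ℕ) → Prime p →
  (∃ λ k → FiniteField.card F ≡ p ^ k) →
  (f : OverField.PolyTX F) →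
  OverField.InXp F p f → OverField.DegX≥1 F f → OverField.IrreducibleTX F f →
  ∃ λ (h : OverField.PolyTX F) →
    OverField.IrreducibleTX F h × (¬ OverField.InXp F p h) ×
    (∀ (P : OverField.PolyT F) → OverField.IrreducibleT F P →
      OverField.ρ F f P ≡ OverField.ρ F h P)
lemma2p10 F zero    (ℕ.prime {{()}} _)
lemma2p10 F (suc m) p-prime (k , card≡pᵏ) f _ (i , 1≤i , fᵢ≉0) f-irr =
  Separable.separable-model F m p-prime k card≡pᵏ i f 1≤i fᵢ≉0 f-irr
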